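{- The $2$-chromatic numbers of closed surfaces are unbounded: for every integer $k$ there is a closed surface $M^2$ with $\chi_2(M^2)\geq k$, i.e. $\sup\{\chi_2(M^2)\mid M^2 \text{ a closed connected surface}\}=\infty$.
   Context: For a finite simplicial complex $K$ and an integer $s\geq 1$, the $s$-chromatic number $\chi_s(K)$ is the minimal number of colors needed to color the vertices of $K$ so that no $(s+1)$-element subset of the vertex set of a face of $K$ is monochromatic. For a triangulable closed connected manifold $M$ of dimension $d$ and $1\leq s<d+1$, $\chi_s(M)=\sup\{\chi_s(K)\mid K \text{ is a triangulation of } M\}$, where a triangulation of $M$ is a simplicial complex whose geometric realization is homeomorphic to $M$. -}

module Defs where

open import Data.Nat using (ℕ; suc; _<_)
open import Data.Fin using (Fin)
open import Data.Product using (Σ; ∃; ∃-syntax; _×_; _,_)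
open import Data.Sum using (_⊎_)
open import Relation.Binary.PropositionalEquality using (_≡_; _≢_)
open import Relation.Binary.Construct.Closure.ReflexiveTransitive using (Star)
open import Relation.Nullary using (¬_)
open import Function.Definitions using (Injective)

-- A finite pure 2-dimensional simplicial complex on the vertex set Fin n,
-- given by its list of facets (triangles) indexed by Fin t.  The faces of
-- the complex are all subsets of these triangles.
record TriComplex (n : ℕ) : Set where
  field
    t   : ℕ
    tri : Fin t → Fin n × Fin n × Fin n

open TriComplex public

_∈T_ : ∀ {n} → Fin n → Fin n × Fin n × Fin n → Set
v ∈T (a , b , c) = v ≡ a ⊎ v ≡ b ⊎ v ≡ c

EdgeOf : ∀ {n} → TriComplex n → Fin n → Fin n → Set
EdgeOf K u w = u ≢ w × ∃[ i ] (u ∈T tri K i × w ∈T tri K i)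

LinkAdj : ∀ {n} → TriComplex n → Fin n → Fin n → Fin n → Set
LinkAdj K v a b =
  a ≢ b × a ≢ v × b ≢ v × ∃[ i ] (v ∈T tri K i × a ∈T tri K i × b ∈T tri K i)

record IsClosedSurface {n : ℕ} (K : TriComplex n) : Set where
  field
    nonempty     : 0 < t K
    distinctVert : ∀ i → let (a , b , c) = tri K i in a ≢ b × a ≢ c × b ≢ c
    distinctTri  : ∀ i j → (∀ v → (v ∈T tri K i → v ∈T tri K j) × (v ∈T tri K j → v ∈T tri K i))
                   → i ≡ j
    allVertices  : ∀ v → ∃[ i ] (v ∈T tri K i)
    edgeTwo      : ∀ a b → EdgeOf K a b →
                   ∃[ i ] ∃[ j ] (i ≢ j × (a ∈T tri K i × b ∈T tri K i)
                                         × (a ∈T tri K j × b ∈T tri K j)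
                                         × (∀ k → a ∈T tri K k → b ∈T tri K k → k ≡ i ⊎ k ≡ j))
    -- the link of every vertex is connected (hence a single circle)
    linkConn     : ∀ v a b → EdgeOf K v a → EdgeOf K v b → Star (LinkAdj K v) a b
    connected    : ∀ u w → Star (EdgeOf K) u w

-- c : Fin n → Fin m is an s-coloring of K: no (s+1)-element subset of the
-- vertex set of a face of K is monochromatic.
IsSColoring : ∀ {n} (s : ℕ) (K : TriComplex n) {m : ℕ} → (Fin n → Fin m) → Set
IsSColoring s K c =
  ∀ i (f : Fin (suc s) → Fin _) → Injective _≡_ _≡_ f → (∀ j → f j ∈T tri K i) →
  ¬ (∀ j j' → c (f j) ≡ c (f j'))

ChromaticAtLeast : ∀ {n} (s : ℕ) (K : TriComplex n) (k : ℕ) → Set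
ChromaticAtLeast {n} s K k = ∀ m → m < k → ¬ (Σ (Fin n → Fin m) (IsSColoring s K))

module Submission where

-- A linear triangle complex H (two triangles share at most one vertex) whose triangles are
-- cyclically ordered around each vertex is a subcomplex of a closed surface.  Each triangle t
-- of H is completed to an octahedron with the three faces at the corners of t removed: a flap
-- with a new apex across every edge of t, and a lid spanned by the three apexes.  Around a vertex
-- x of H, bridge triangles join the holes left at the corners of consecutive triangles, and the
-- cycle of apexes that remains is coned off from a new hub vertex.
--
-- Let H have the edges of the complete graph K_N as vertices and its triangles as triangles.
-- A 2-colouring of the surface restricts to an edge colouring of K_N without monochromatic
-- triangle, which by Ramsey's theorem needs at least k colours once N is large enough.

open import Data.Empty using (⊥; ⊥-elim)
open import Data.Fin using (Fin; zero; suc; toℕ; fromℕ; inject₁; lower₁; punchIn; punchOut)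
import Data.Fin as Fin
open import Data.Fin.Induction using (<-weakInduction)
open import Data.Fin.Properties
  using (toℕ-fromℕ; toℕ-inject₁; inject₁-lower₁; lower₁-inject₁′; toℕ-injective; toℕ-inject₁-≢; toℕ<n;
         punchInᵢ≢i; punchIn-injective; punchIn-punchOut; punchOut-punchIn; punchOut-cong; punchOut-injective; +↔⊎; *↔×)
open import Data.List using (List; []; _∷_; length; lookup; deduplicate; filter; concatMap; cartesianProduct; allFin)
open import Data.List.Membership.Propositional using (_∈_; lose; find)
open import Data.List.Membership.Propositional.Properties
  using (∈-deduplicate⁺; ∈-lookup; ∈-filter⁻; ∈-concatMap⁺; ∈-cartesianProduct⁺; ∈-allFin)
open import Data.List.Membership.Propositional.Properties.WithK using (unique⇒irrelevant)
open import Data.List.Properties using (length-tabulate)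
open import Data.List.Relation.Binary.Sublist.Heterogeneous.Properties using (length-mono-≤; filter-Sublist; ⊆-filter-Sublist)
open import Data.List.Relation.Binary.Sublist.Propositional using (⊆-refl)
open import Data.List.Relation.Unary.All using (_∷_)
import Data.List.Relation.Unary.All as All
open import Data.List.Relation.Unary.AllPairs using (AllPairs; _∷_)
import Data.List.Relation.Unary.AllPairs.Properties as AllPairs
open import Data.List.Relation.Unary.Any using (Any; here; there; index; any?)
open import Data.List.Relation.Unary.Any.Properties using (lookup-index)
open import Data.List.Relation.Unary.Unique.DecPropositional.Properties using (deduplicate-!)
open import Data.Nat using (ℕ; zero; suc; _+_; _*_; _≤_; s≤s; z≤n; z<s; s<s)
import Data.Nat.Properties as ℕ
open import Data.Product using (Σ; ∃-syntax; _×_; _,_; proj₁; proj₂; uncurry)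
open import Data.Product.Function.NonDependent.Propositional using (_×-↔_)
open import Data.Sum using (_⊎_; inj₁; inj₂)
open import Data.Sum.Function.Propositional using (_⊎-↔_)
open import Function using (id; _↔_; Inverse; Injection; mk↔ₛ′)
open import Function.Properties.Inverse using (↔⇒↣; ↔-refl; ↔-sym; ↔-trans)
open import Relation.Binary.Construct.Closure.ReflexiveTransitive using (Star; ε; _◅_; _◅◅_; gmap; reverse; concat)
open import Relation.Binary.Definitions using (DecidableEquality; tri<; tri≈; tri>)
open import Relation.Binary.PropositionalEquality
  using (_≡_; _≢_; refl; sym; trans; cong; cong₂; subst; subst₂; module ≡-Reasoning)
open import Relation.Nullary using (¬_; Dec; yes; no; contradiction)
open import Relation.Nullary.Decidable using (map′; _×-dec_; recompute)
open import Relation.Unary using (Decidable)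
open import Relation.Unary.Properties using (∁?)

open import Defs

next : ∀ {m} → Fin (suc m) → Fin (suc m)
next {m} i with m ℕ.≟ toℕ i
... | yes _   = zero
... | no m≢i = suc (lower₁ i m≢i)

prev : ∀ {m} → Fin (suc m) → Fin (suc m)
prev {m} zero = fromℕ m
prev (suc i)  = inject₁ i

prev-next : ∀ {m} (i : Fin (suc m)) → prev (next i) ≡ i
prev-next {m} i with m ℕ.≟ toℕ i
... | yes m≡i = toℕ-injective (trans (toℕ-fromℕ m) m≡i)
... | no m≢i  = inject₁-lower₁ i m≢i

next-inject₁ : ∀ {m} (i : Fin m) → next (inject₁ i) ≡ suc i
next-inject₁ {m} i with m ℕ.≟ toℕ (inject₁ i)
... | yes m≡i = contradiction m≡i (toℕ-inject₁-≢ i)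
... | no m≢i  = cong suc (lower₁-inject₁′ i m≢i)

next-prev : ∀ {m} (i : Fin (suc m)) → next (prev i) ≡ i
next-prev {m} zero with m ℕ.≟ toℕ (fromℕ m)
... | yes _   = refl
... | no m≢m = contradiction (sym (toℕ-fromℕ m)) m≢m
next-prev (suc i) = next-inject₁ i

next-injective : ∀ {m} {i j : Fin (suc m)} → next i ≡ next j → i ≡ j
next-injective {i = i} {j} e = trans (sym (prev-next i)) (trans (cong prev e) (prev-next j))

prev-injective : ∀ {m} {i j : Fin (suc m)} → prev i ≡ prev j → i ≡ j
prev-injective {i = i} {j} e = trans (sym (next-prev i)) (trans (cong next e) (next-prev j))

prev-≢ : ∀ {m} (i : Fin (suc (suc m))) → prev i ≢ i
prev-≢ zero    ()
prev-≢ (suc i) e = ℕ.1+n≢n (sym (trans (sym (toℕ-inject₁ i)) (cong toℕ e)))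

next-≢ : ∀ {m} (i : Fin (suc (suc m))) → next i ≢ i
next-≢ i e = prev-≢ i (trans (cong prev (sym e)) (prev-next i))

CyclicStep : ∀ {m} → Fin (suc m) → Fin (suc m) → Set
CyclicStep i j = next i ≡ j ⊎ next j ≡ i

next-connected : ∀ {m} (i : Fin (suc m)) → Star CyclicStep zero i
next-connected = <-weakInduction (Star CyclicStep zero) ε
  (λ j zero⇝j → zero⇝j ◅◅ inj₁ (next-inject₁ j) ◅ ε)

cyclic-reach : ∀ {m} {A : Set} {R : A → A → Set} → (∀ {a b} → R a b → R b a) → (f : Fin (suc m) → A) →
               (∀ k → Star R (f k) (f (next k))) → ∀ i → Star R (f zero) (f i)
cyclic-reach {R = R} R-sym f step i = concat (gmap f walk (next-connected i))
  where
  walk : ∀ {j k} → CyclicStep j k → Star R (f j) (f k)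
  walk (inj₁ refl) = step _
  walk (inj₂ refl) = reverse R-sym (step _)

module _ {n : ℕ} {i j : Fin (suc (suc n))} (i≢j : i ≢ j) where

  punchIn₂ : Fin n → Fin (suc (suc n))
  punchIn₂ k = punchIn i (punchIn (punchOut i≢j) k)

  punchIn₂-≢ˡ : ∀ k → punchIn₂ k ≢ i
  punchIn₂-≢ˡ k = punchInᵢ≢i i _

  punchIn₂-≢ʳ : ∀ k → punchIn₂ k ≢ j
  punchIn₂-≢ʳ k e = punchInᵢ≢i (punchOut i≢j) k (punchIn-injective i _ _ (trans e (sym (punchIn-punchOut i≢j))))

  punchOut₂ : ∀ {l} → l ≢ i → l ≢ j → Fin n
  punchOut₂ {l} l≢i l≢j = punchOut {i = punchOut i≢j} {j = punchOut (λ e → l≢i (sym e))}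
                                   (λ e → l≢j (sym (punchOut-injective i≢j _ e)))

  punchIn₂-punchOut₂ : ∀ {l} (l≢i : l ≢ i) (l≢j : l ≢ j) → punchIn₂ (punchOut₂ l≢i l≢j) ≡ l
  punchIn₂-punchOut₂ l≢i l≢j = trans (cong (punchIn i) (punchIn-punchOut _)) (punchIn-punchOut _)

  punchOut₂-irrelevant : ∀ {l} (p p′ : l ≢ i) (q q′ : l ≢ j) → punchOut₂ p q ≡ punchOut₂ p′ q′
  punchOut₂-irrelevant _ _ _ _ = punchOut-cong (punchOut i≢j) (punchOut-cong i refl)

  punchOut₂-punchIn₂ : ∀ k → punchOut₂ (punchIn₂-≢ˡ k) (punchIn₂-≢ʳ k) ≡ k
  punchOut₂-punchIn₂ k = trans (punchOut-cong (punchOut i≢j) (punchOut-punchIn i)) (punchOut-punchIn (punchOut i≢j))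

pattern c₀ = zero
pattern c₁ = suc zero
pattern c₂ = suc (suc zero)

Corner : Set
Corner = Fin 3

next≢prev : (r : Corner) → next r ≢ prev r
next≢prev c₀ ()
next≢prev c₁ ()
next≢prev c₂ ()

next-next : (r : Corner) → next (next r) ≡ prev r
next-next c₀ = refl
next-next c₁ = refl
next-next c₂ = refl

prev-prev : (r : Corner) → prev (prev r) ≡ next r
prev-prev c₀ = refl
prev-prev c₁ = refl
prev-prev c₂ = refl

prev≡next⇒≡next : ∀ {a b : Corner} → prev a ≡ next b → b ≡ next a
prev≡next⇒≡next {a} {b} e = trans (sym (prev-next b)) (trans (cong prev (sym e)) (prev-prev a))

≢⇒next⊎prev : ∀ {r r′ : Corner} → r′ ≢ r → r′ ≡ next r ⊎ r′ ≡ prev r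
≢⇒next⊎prev {c₀} {c₀} r′≢r = contradiction refl r′≢r
≢⇒next⊎prev {c₀} {c₁} _    = inj₁ refl
≢⇒next⊎prev {c₀} {c₂} _    = inj₂ refl
≢⇒next⊎prev {c₁} {c₀} _    = inj₂ refl
≢⇒next⊎prev {c₁} {c₁} r′≢r = contradiction refl r′≢r
≢⇒next⊎prev {c₁} {c₂} _    = inj₁ refl
≢⇒next⊎prev {c₂} {c₀} _    = inj₁ refl
≢⇒next⊎prev {c₂} {c₁} _    = inj₂ refl
≢⇒next⊎prev {c₂} {c₂} r′≢r = contradiction refl r′≢r

≢next∧≢prev⇒≡ : ∀ {r r′ : Corner} → r′ ≢ next r → r′ ≢ prev r → r′ ≡ r
≢next∧≢prev⇒≡ {r} {r′} r′≢next r′≢prev with r′ Fin.≟ r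
... | yes r′≡r = r′≡r
... | no r′≢r with ≢⇒next⊎prev r′≢r
...   | inj₁ r′≡next = contradiction r′≡next r′≢next
...   | inj₂ r′≡prev = contradiction r′≡prev r′≢prev

_∈▵_ : {A : Set} → A → A × A × A → Set
x ∈▵ (a , b , c) = x ≡ a ⊎ x ≡ b ⊎ x ≡ c

Sides : {A : Set} → (A → A → Set) → A × A × A → Set
Sides R (a , b , c) = R a b × R a c × R b c

Sides-lookup : {A : Set} {R : A → A → Set} → (∀ {a b} → R a b → R b a) →
               ∀ {x a b} → Sides R x → a ∈▵ x → b ∈▵ x → a ≢ b → R a b
Sides-lookup _   _               (inj₁ refl)        (inj₁ refl)        a≢a = contradiction refl a≢a
Sides-lookup _   (ab , _  , _)   (inj₁ refl)        (inj₂ (inj₁ refl)) _   = ab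
Sides-lookup _   (_  , ac , _)   (inj₁ refl)        (inj₂ (inj₂ refl)) _   = ac
Sides-lookup sym (ab , _  , _)   (inj₂ (inj₁ refl)) (inj₁ refl)        _   = sym ab
Sides-lookup _   _               (inj₂ (inj₁ refl)) (inj₂ (inj₁ refl)) b≢b = contradiction refl b≢b
Sides-lookup _   (_  , _  , bc)  (inj₂ (inj₁ refl)) (inj₂ (inj₂ refl)) _   = bc
Sides-lookup sym (_  , ac , _)   (inj₂ (inj₂ refl)) (inj₁ refl)        _   = sym ac
Sides-lookup sym (_  , _  , bc)  (inj₂ (inj₂ refl)) (inj₂ (inj₁ refl)) _   = sym bc
Sides-lookup _   _               (inj₂ (inj₂ refl)) (inj₂ (inj₂ refl)) c≢c = contradiction refl c≢c

∈▵₁ : {A : Set} {a b c : A} → a ∈▵ (a , b , c)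
∈▵₁ = inj₁ refl

∈▵₂ : {A : Set} {a b c : A} → b ∈▵ (a , b , c)
∈▵₂ = inj₂ (inj₁ refl)

∈▵₃ : {A : Set} {a b c : A} → c ∈▵ (a , b , c)
∈▵₃ = inj₂ (inj₂ refl)

lookup▵ : {A : Set} → A × A × A → Corner → A
lookup▵ (a , _ , _) c₀ = a
lookup▵ (_ , b , _) c₁ = b
lookup▵ (_ , _ , c) c₂ = c

lookup▵-∈ : {A : Set} (x : A × A × A) (j : Corner) → lookup▵ x j ∈▵ x
lookup▵-∈ _ c₀ = ∈▵₁
lookup▵-∈ _ c₁ = ∈▵₂
lookup▵-∈ _ c₂ = ∈▵₃

lookup▵-injective : {A : Set} {x : A × A × A} → Sides _≢_ x → ∀ {j j′} → lookup▵ x j ≡ lookup▵ x j′ → j ≡ j′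
lookup▵-injective _              {c₀} {c₀} _ = refl
lookup▵-injective _              {c₁} {c₁} _ = refl
lookup▵-injective _              {c₂} {c₂} _ = refl
lookup▵-injective (a≢b , _ , _)  {c₀} {c₁} e = contradiction e a≢b
lookup▵-injective (_ , a≢c , _)  {c₀} {c₂} e = contradiction e a≢c
lookup▵-injective (a≢b , _ , _)  {c₁} {c₀} e = contradiction (sym e) a≢b
lookup▵-injective (_ , _ , b≢c)  {c₁} {c₂} e = contradiction e b≢c
lookup▵-injective (_ , a≢c , _)  {c₂} {c₀} e = contradiction (sym e) a≢c
lookup▵-injective (_ , _ , b≢c)  {c₂} {c₁} e = contradiction (sym e) b≢c

lookup▵-constant : {A C : Set} {x : A × A × A} (g : A → C) → Sides (λ a b → g a ≡ g b) x →
                   ∀ j j′ → g (lookup▵ x j) ≡ g (lookup▵ x j′)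
lookup▵-constant {x = x} g (ab , ac , _) j j′ = trans (sym (from-first j)) (from-first j′)
  where
  from-first : ∀ j → g (lookup▵ x c₀) ≡ g (lookup▵ x j)
  from-first c₀ = refl
  from-first c₁ = ab
  from-first c₂ = ac

index-∈-lookup : {A : Set} (xs : List A) (i : Fin (length xs)) → index (∈-lookup {xs = xs} i) ≡ i
index-∈-lookup (_ ∷ _)  zero    = refl
index-∈-lookup (_ ∷ xs) (suc i) = cong suc (index-∈-lookup xs i)

Finite : Set → Set
Finite A = Σ ℕ (λ n → A ↔ Fin n)

finite : {A : Set} → DecidableEquality A → (xs : List A) → (∀ a → a ∈ xs) → Finite A
finite {A} _≟_ xs complete = length ys , mk↔ₛ′ position (lookup ys) position-lookup lookup-position
  where
  ys : List A
  ys = deduplicate _≟_ xs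
  ∈ys : ∀ a → a ∈ ys
  ∈ys a = ∈-deduplicate⁺ _≟_ (complete a)
  position : A → Fin (length ys)
  position a = index (∈ys a)
  lookup-position : ∀ a → lookup ys (position a) ≡ a
  lookup-position a = sym (lookup-index (∈ys a))
  position-lookup : ∀ i → position (lookup ys i) ≡ i
  position-lookup i = trans (cong index (unique⇒irrelevant (deduplicate-! _≟_ xs) (∈ys (lookup ys i)) (∈-lookup i)))
                            (index-∈-lookup ys i)

finite-⊎ : {A B : Set} → Finite A → Finite B → Finite (A ⊎ B)
finite-⊎ (a , A↔) (b , B↔) = a + b , ↔-trans (A↔ ⊎-↔ B↔) (↔-sym +↔⊎)

finite-× : {A B : Set} → Finite A → Finite B → Finite (A × B)
finite-× (a , A↔) (b , B↔) = a * b , ↔-trans (A↔ ×-↔ B↔) (↔-sym *↔×)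

finite-↔ : {A B : Set} → A ↔ B → Finite B → Finite A
finite-↔ A↔B (b , B↔) = b , ↔-trans A↔B B↔

module _ {V T : Set} (tri : T → V × V × V) where

  EdgeOf′ : V → V → Set
  EdgeOf′ u w = u ≢ w × ∃[ i ] (u ∈▵ tri i × w ∈▵ tri i)

  LinkAdj′ : V → V → V → Set
  LinkAdj′ v a b = a ≢ b × a ≢ v × b ≢ v × ∃[ i ] (v ∈▵ tri i × a ∈▵ tri i × b ∈▵ tri i)

  InExactlyTwo : V → V → Set
  InExactlyTwo a b = ∃[ i ] ∃[ j ] (i ≢ j × (a ∈▵ tri i × b ∈▵ tri i) × (a ∈▵ tri j × b ∈▵ tri j)
                                    × (∀ k → a ∈▵ tri k → b ∈▵ tri k → k ≡ i ⊎ k ≡ j))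

  EdgeOf′-sym : ∀ {u w} → EdgeOf′ u w → EdgeOf′ w u
  EdgeOf′-sym (u≢w , i , u∈ , w∈) = (λ e → u≢w (sym e)) , i , w∈ , u∈

  LinkAdj′-sym : ∀ {v a b} → LinkAdj′ v a b → LinkAdj′ v b a
  LinkAdj′-sym (a≢b , a≢v , b≢v , i , v∈ , a∈ , b∈) = (λ e → a≢b (sym e)) , b≢v , a≢v , i , v∈ , b∈ , a∈

  record SameVertices (i j : T) : Set where
    field
      fwd : ∀ {v} → v ∈▵ tri i → v ∈▵ tri j
      bwd : ∀ {v} → v ∈▵ tri j → v ∈▵ tri i

  record IsClosedSurface′ : Set where
    field
      someTriangle : T
      distinctVert : ∀ i → Sides _≢_ (tri i)
      distinctTri  : ∀ i j → SameVertices i j → i ≡ j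
      allVertices  : ∀ v → ∃[ i ] (v ∈▵ tri i)
      edgeTwo      : ∀ a b → EdgeOf′ a b → InExactlyTwo a b
      linkConn     : ∀ v a b → EdgeOf′ v a → EdgeOf′ v b → Star (LinkAdj′ v) a b
      connected    : ∀ u w → Star EdgeOf′ u w

module Relabel {V T : Set} (tri : T → V × V × V) {n t : ℕ} (V↔ : V ↔ Fin n) (T↔ : T ↔ Fin t) where

  code : V → Fin n
  code = Inverse.to V↔

  decode : Fin n → V
  decode = Inverse.from V↔

  codeT : T → Fin t
  codeT = Inverse.to T↔

  decodeT : Fin t → T
  decodeT = Inverse.from T↔

  code-decode : ∀ u → code (decode u) ≡ u
  code-decode = Inverse.strictlyInverseˡ V↔

  decode-code : ∀ a → decode (code a) ≡ a
  decode-code = Inverse.strictlyInverseʳ V↔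

  codeT-decodeT : ∀ i → codeT (decodeT i) ≡ i
  codeT-decodeT = Inverse.strictlyInverseˡ T↔

  decodeT-codeT : ∀ j → decodeT (codeT j) ≡ j
  decodeT-codeT = Inverse.strictlyInverseʳ T↔

  code-injective : ∀ {a b} → code a ≡ code b → a ≡ b
  code-injective = Injection.injective (↔⇒↣ V↔)

  codeT-injective : ∀ {i j} → codeT i ≡ codeT j → i ≡ j
  codeT-injective = Injection.injective (↔⇒↣ T↔)

  decode-injective : ∀ {u w} → decode u ≡ decode w → u ≡ w
  decode-injective = Injection.injective (↔⇒↣ (↔-sym V↔))

  map₃ : {A B : Set} → (A → B) → A × A × A → B × B × B
  map₃ f (a , b , c) = f a , f b , f c

  relabelled : TriComplex n
  relabelled = record { t = t ; tri = λ i → map₃ code (tri (decodeT i)) }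

  private
    K : Fin t → Fin n × Fin n × Fin n
    K = Defs.tri relabelled

  ∈-map₃⁺ : ∀ {a} x → a ∈▵ x → code a ∈T map₃ code x
  ∈-map₃⁺ _ (inj₁ refl)        = inj₁ refl
  ∈-map₃⁺ _ (inj₂ (inj₁ refl)) = inj₂ (inj₁ refl)
  ∈-map₃⁺ _ (inj₂ (inj₂ refl)) = inj₂ (inj₂ refl)

  ∈-map₃⁻ : ∀ {u} x → u ∈T map₃ code x → decode u ∈▵ x
  ∈-map₃⁻ (a , _ , _) (inj₁ u≡a)        = inj₁ (trans (cong decode u≡a) (decode-code a))
  ∈-map₃⁻ (_ , b , _) (inj₂ (inj₁ u≡b)) = inj₂ (inj₁ (trans (cong decode u≡b) (decode-code b)))
  ∈-map₃⁻ (_ , _ , c) (inj₂ (inj₂ u≡c)) = inj₂ (inj₂ (trans (cong decode u≡c) (decode-code c)))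

  ∈-relabelled⁺ : ∀ {a} j → a ∈▵ tri j → code a ∈T K (codeT j)
  ∈-relabelled⁺ {a} j a∈ = subst (λ k → code a ∈T map₃ code (tri k)) (sym (decodeT-codeT j)) (∈-map₃⁺ (tri j) a∈)

  ∈-relabelled⁺′ : ∀ {u} j → decode u ∈▵ tri j → u ∈T K (codeT j)
  ∈-relabelled⁺′ {u} j u∈ = subst (λ w → w ∈T K (codeT j)) (code-decode u) (∈-relabelled⁺ j u∈)

  ∈-relabelled⁻ : ∀ {u} i → u ∈T K i → decode u ∈▵ tri (decodeT i)
  ∈-relabelled⁻ i = ∈-map₃⁻ (tri (decodeT i))

  edge⁻ : ∀ {u w} → EdgeOf relabelled u w → EdgeOf′ tri (decode u) (decode w)
  edge⁻ (u≢w , i , u∈ , w∈) = (λ e → u≢w (decode-injective e)) , decodeT i , ∈-relabelled⁻ i u∈ , ∈-relabelled⁻ i w∈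

  edge⁺ : ∀ {a b} → EdgeOf′ tri a b → EdgeOf relabelled (code a) (code b)
  edge⁺ (a≢b , j , a∈ , b∈) = (λ e → a≢b (code-injective e)) , codeT j , ∈-relabelled⁺ j a∈ , ∈-relabelled⁺ j b∈

  link⁺ : ∀ {u a b} → LinkAdj′ tri (decode u) a b → LinkAdj relabelled u (code a) (code b)
  link⁺ {u} (a≢b , a≢u , b≢u , j , u∈ , a∈ , b∈) =
    (λ e → a≢b (code-injective e)) ,
    (λ e → a≢u (trans (sym (decode-code _)) (cong decode e))) ,
    (λ e → b≢u (trans (sym (decode-code _)) (cong decode e))) ,
    codeT j , ∈-relabelled⁺′ j u∈ , ∈-relabelled⁺ j a∈ , ∈-relabelled⁺ j b∈

  star-code-decode : ∀ {R : Fin n → Fin n → Set} {u w} → Star R (code (decode u)) (code (decode w)) → Star R u w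
  star-code-decode {R} {u} {w} = subst₂ (Star R) (code-decode u) (code-decode w)

  isClosedSurface : IsClosedSurface′ tri → IsClosedSurface relabelled
  isClosedSurface S = record
    { nonempty     = ℕ.≤-<-trans z≤n (toℕ<n (codeT someTriangle))
    ; distinctVert = λ i → let (a≢b , a≢c , b≢c) = distinctVert (decodeT i) in
                       (λ e → a≢b (code-injective e)) , (λ e → a≢c (code-injective e)) , (λ e → b≢c (code-injective e))
    ; distinctTri  = λ i j same → trans (sym (codeT-decodeT i)) (trans (cong codeT (distinctTri _ _ (sameDecoded same))) (codeT-decodeT j))
    ; allVertices  = λ u → let (j , u∈) = allVertices (decode u) in codeT j , ∈-relabelled⁺′ j u∈
    ; edgeTwo      = λ a b ab → inExactlyTwo (edgeTwo _ _ (edge⁻ ab))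
    ; linkConn     = λ u a b ua ub → star-code-decode (gmap code link⁺ (linkConn _ _ _ (edge⁻ ua) (edge⁻ ub)))
    ; connected    = λ u w → star-code-decode (gmap code edge⁺ (connected (decode u) (decode w)))
    }
    where
    open IsClosedSurface′ S
    sameDecoded : ∀ {i j} → (∀ v → (v ∈T K i → v ∈T K j) × (v ∈T K j → v ∈T K i)) → SameVertices tri (decodeT i) (decodeT j)
    sameDecoded {i} {j} same = record
      { fwd = λ {a} a∈ → subst (_∈▵ tri (decodeT j)) (decode-code a) (∈-relabelled⁻ j (proj₁ (same (code a)) (∈-map₃⁺ (tri (decodeT i)) a∈)))
      ; bwd = λ {a} a∈ → subst (_∈▵ tri (decodeT i)) (decode-code a) (∈-relabelled⁻ i (proj₂ (same (code a)) (∈-map₃⁺ (tri (decodeT j)) a∈)))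
      }
    inExactlyTwo : ∀ {u w} → InExactlyTwo tri (decode u) (decode w) →
      ∃[ i ] ∃[ j ] (i ≢ j × (u ∈T K i × w ∈T K i) × (u ∈T K j × w ∈T K j) × (∀ k → u ∈T K k → w ∈T K k → k ≡ i ⊎ k ≡ j))
    inExactlyTwo (i , j , i≢j , (u∈i , w∈i) , (u∈j , w∈j) , only) =
      codeT i , codeT j , (λ e → i≢j (codeT-injective e)) ,
      (∈-relabelled⁺′ i u∈i , ∈-relabelled⁺′ i w∈i) , (∈-relabelled⁺′ j u∈j , ∈-relabelled⁺′ j w∈j) ,
      λ k u∈k w∈k → Data.Sum.map (λ e → trans (sym (codeT-decodeT k)) (cong codeT e)) (λ e → trans (sym (codeT-decodeT k)) (cong codeT e))
                                  (only (decodeT k) (∈-relabelled⁻ k u∈k) (∈-relabelled⁻ k w∈k))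

  no-monochromatic-triangle : ∀ {m} {c : Fin n → Fin m} → IsSColoring 2 relabelled c →
                              ∀ i → Sides _≢_ (tri i) → ¬ Sides (λ a b → c (code a) ≡ c (code b)) (tri i)
  no-monochromatic-triangle {c = c} colouring i distinct monochromatic =
    colouring (codeT i) (λ j → code (lookup▵ (tri i) j)) (λ e → lookup▵-injective distinct (code-injective e))
              (λ j → ∈-relabelled⁺ i (lookup▵-∈ (tri i) j)) (lookup▵-constant (λ a → c (code a)) monochromatic)

Adjacent : {V T : Set} → (T → Corner → V) → V → V → Set
Adjacent corner a b = ∃[ t ] ∃[ r ] ∃[ r′ ] (r ≢ r′ × corner t r ≡ a × corner t r′ ≡ b)

Adjacent-sym : {V T : Set} {corner : T → Corner → V} → ∀ {x y} → Adjacent corner x y → Adjacent corner y x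
Adjacent-sym (t , r , r′ , r≢r′ , e , e′) = t , r′ , r , (λ e″ → r≢r′ (sym e″)) , e′ , e

module Completion
  {V T : Set}
  (corner : T → Corner → V)
  (corner-injective : ∀ t {r r′} → corner t r ≡ corner t r′ → r ≡ r′)
  (linear : ∀ {t t′ r₁ r₂ r₁′ r₂′} → r₁ ≢ r₂ → corner t r₁ ≡ corner t′ r₁′ → corner t r₂ ≡ corner t′ r₂′ → t ≡ t′)
  {m : ℕ}
  (star : V → Fin (suc (suc m)) → T × Corner)
  (position : T × Corner → Fin (suc (suc m)))
  (star-corner : ∀ x k → uncurry corner (star x k) ≡ x)
  (star-position : ∀ q → star (uncurry corner q) (position q) ≡ q)
  (position-star : ∀ x k → position (star x k) ≡ k)
  (connected : ∀ x y → Star (Adjacent corner) x y)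
  (t₀ : T)
  where

  Slot : Set
  Slot = T × Corner

  vertexOf : Slot → V
  vertexOf = uncurry corner

  σ σ⁻¹ : Slot → Slot
  σ   q = star (vertexOf q) (next (position q))
  σ⁻¹ q = star (vertexOf q) (prev (position q))

  σ-vertex : ∀ q → vertexOf (σ q) ≡ vertexOf q
  σ-vertex q = star-corner _ _

  σ⁻¹-vertex : ∀ q → vertexOf (σ⁻¹ q) ≡ vertexOf q
  σ⁻¹-vertex q = star-corner _ _

  σ⁻¹-σ : ∀ q → σ⁻¹ (σ q) ≡ q
  σ⁻¹-σ q = begin
    star (vertexOf (σ q)) (prev (position (σ q)))            ≡⟨ cong (λ x → star x (prev (position (σ q)))) (σ-vertex q) ⟩
    star (vertexOf q) (prev (position (σ q)))                ≡⟨ cong (λ k → star (vertexOf q) (prev k)) (position-star _ _) ⟩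
    star (vertexOf q) (prev (next (position q)))             ≡⟨ cong (star (vertexOf q)) (prev-next (position q)) ⟩
    star (vertexOf q) (position q)                           ≡⟨ star-position q ⟩
    q                                                        ∎
    where open ≡-Reasoning

  σ-σ⁻¹ : ∀ q → σ (σ⁻¹ q) ≡ q
  σ-σ⁻¹ q = begin
    star (vertexOf (σ⁻¹ q)) (next (position (σ⁻¹ q)))       ≡⟨ cong (λ x → star x (next (position (σ⁻¹ q)))) (σ⁻¹-vertex q) ⟩
    star (vertexOf q) (next (position (σ⁻¹ q)))             ≡⟨ cong (λ k → star (vertexOf q) (next k)) (position-star _ _) ⟩
    star (vertexOf q) (next (prev (position q)))            ≡⟨ cong (star (vertexOf q)) (next-prev (position q)) ⟩
    star (vertexOf q) (position q)                          ≡⟨ star-position q ⟩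
    q                                                       ∎
    where open ≡-Reasoning

  σ-star : ∀ x k → σ (star x k) ≡ star x (next k)
  σ-star x k = trans (cong (λ y → star y (next (position (star x k)))) (star-corner x k))
                     (cong (λ i → star x (next i)) (position-star x k))

  slot-≡ : ∀ {q q′ : Slot} → proj₁ q ≡ proj₁ q′ → vertexOf q ≡ vertexOf q′ → q ≡ q′
  slot-≡ {t , _} refl same-vertex = cong (t ,_) (corner-injective t same-vertex)

  σ-moves : ∀ q → proj₁ (σ q) ≢ proj₁ q
  σ-moves q same = next-≢ (position q) (begin
    next (position q)   ≡⟨ sym (position-star _ _) ⟩
    position (σ q)      ≡⟨ cong position (slot-≡ same (σ-vertex q)) ⟩
    position q          ∎)
    where open ≡-Reasoning

  data Vertex : Set where
    old  : V → Vertex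
    apex : T → Corner → Vertex
    hub  : V → Vertex

  data Triangle : Set where
    face      : T → Triangle
    flap      : T → Corner → Triangle
    lid       : T → Triangle
    bridge    : Slot → Triangle
    hubBridge : Slot → Triangle
    hubCorner : Slot → Triangle

  apex⁺ apex⁻ : Slot → Vertex
  apex⁺ q = apex (proj₁ q) (next (proj₂ q))
  apex⁻ q = apex (proj₁ q) (prev (proj₂ q))

  triangle : Triangle → Vertex × Vertex × Vertex
  triangle (face t)      = old (corner t c₀) , old (corner t c₁) , old (corner t c₂)
  triangle (flap t r)    = apex t r , old (corner t (next r)) , old (corner t (prev r))
  triangle (lid t)       = apex t c₀ , apex t c₁ , apex t c₂
  triangle (bridge q)    = old (vertexOf q) , apex⁻ q , apex⁺ (σ q)
  triangle (hubBridge q) = hub (vertexOf q) , apex⁻ q , apex⁺ (σ q)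
  triangle (hubCorner q) = hub (vertexOf q) , apex⁺ q , apex⁻ q

  _on_ : Vertex → Triangle → Set
  v on k = v ∈▵ triangle k

  old-injective : ∀ {x y : V} → old x ≡ old y → x ≡ y
  old-injective refl = refl

  apex-triangle : ∀ {t t′ : T} {r r′ : Corner} → apex t r ≡ apex t′ r′ → t ≡ t′
  apex-triangle refl = refl

  apex-corner : ∀ {t t′ : T} {r r′ : Corner} → apex t r ≡ apex t′ r′ → r ≡ r′
  apex-corner refl = refl

  apex⁻-injective : ∀ {q q′} → apex⁻ q ≡ apex⁻ q′ → q ≡ q′
  apex⁻-injective {_ , _} {_ , _} e = cong₂ _,_ (apex-triangle e) (prev-injective (apex-corner e))

  apex⁺-injective : ∀ {q q′} → apex⁺ q ≡ apex⁺ q′ → q ≡ q′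
  apex⁺-injective {_ , _} {_ , _} e = cong₂ _,_ (apex-triangle e) (next-injective (apex-corner e))

  apex⁺≢apex⁻ : ∀ {q q′} → vertexOf q ≡ vertexOf q′ → apex⁺ q ≢ apex⁻ q′
  apex⁺≢apex⁻ {t , r} {t′ , r′} same e with refl ← apex-triangle e =
    next≢prev r (trans (apex-corner e) (cong prev (sym (corner-injective t same))))

  apex⁻≢apex⁺σ : ∀ q → apex⁻ q ≢ apex⁺ (σ q)
  apex⁻≢apex⁺σ q e = σ-moves q (sym (apex-triangle e))

  OldOn : V → Triangle → Set
  OldOn x (face t)   = ∃[ r ] (x ≡ corner t r)
  OldOn x (flap t s) = ∃[ r ] (r ≢ s × x ≡ corner t r)
  OldOn x (bridge q) = x ≡ vertexOf q
  OldOn x _          = ⊥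

  old-on : ∀ {x} k → old x on k → OldOn x k
  old-on (face t)      (inj₁ refl)        = c₀ , refl
  old-on (face t)      (inj₂ (inj₁ refl)) = c₁ , refl
  old-on (face t)      (inj₂ (inj₂ refl)) = c₂ , refl
  old-on (flap t s)    (inj₂ (inj₁ refl)) = next s , next-≢ s , refl
  old-on (flap t s)    (inj₂ (inj₂ refl)) = prev s , prev-≢ s , refl
  old-on (bridge q)    (inj₁ refl)        = refl
  old-on (flap t s)    (inj₁ ())
  old-on (lid t)       (inj₁ ())
  old-on (lid t)       (inj₂ (inj₁ ()))
  old-on (lid t)       (inj₂ (inj₂ ()))
  old-on (bridge q)    (inj₂ (inj₁ ()))
  old-on (bridge q)    (inj₂ (inj₂ ()))
  old-on (hubBridge q) (inj₁ ())
  old-on (hubBridge q) (inj₂ (inj₁ ()))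
  old-on (hubBridge q) (inj₂ (inj₂ ()))
  old-on (hubCorner q) (inj₁ ())
  old-on (hubCorner q) (inj₂ (inj₁ ()))
  old-on (hubCorner q) (inj₂ (inj₂ ()))

  ApexOn : T → Corner → Triangle → Set
  ApexOn t s (flap t′ s′)  = t ≡ t′ × s ≡ s′
  ApexOn t s (lid t′)      = t ≡ t′
  ApexOn t s (bridge q)    = apex t s ≡ apex⁻ q ⊎ apex t s ≡ apex⁺ (σ q)
  ApexOn t s (hubBridge q) = apex t s ≡ apex⁻ q ⊎ apex t s ≡ apex⁺ (σ q)
  ApexOn t s (hubCorner q) = apex t s ≡ apex⁺ q ⊎ apex t s ≡ apex⁻ q
  ApexOn t s (face _)      = ⊥

  apex-on : ∀ {t s} k → apex t s on k → ApexOn t s k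
  apex-on (flap t s)    (inj₁ refl)        = refl , refl
  apex-on (lid t)       (inj₁ refl)        = refl
  apex-on (lid t)       (inj₂ (inj₁ refl)) = refl
  apex-on (lid t)       (inj₂ (inj₂ refl)) = refl
  apex-on (bridge q)    (inj₂ (inj₁ e))    = inj₁ e
  apex-on (bridge q)    (inj₂ (inj₂ e))    = inj₂ e
  apex-on (hubBridge q) (inj₂ (inj₁ e))    = inj₁ e
  apex-on (hubBridge q) (inj₂ (inj₂ e))    = inj₂ e
  apex-on (hubCorner q) (inj₂ (inj₁ e))    = inj₁ e
  apex-on (hubCorner q) (inj₂ (inj₂ e))    = inj₂ e
  apex-on (face t)      (inj₁ ())
  apex-on (face t)      (inj₂ (inj₁ ()))
  apex-on (face t)      (inj₂ (inj₂ ()))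
  apex-on (flap t s)    (inj₂ (inj₁ ()))
  apex-on (flap t s)    (inj₂ (inj₂ ()))
  apex-on (bridge q)    (inj₁ ())
  apex-on (hubBridge q) (inj₁ ())
  apex-on (hubCorner q) (inj₁ ())

  HubOn : V → Triangle → Set
  HubOn x (hubBridge q) = x ≡ vertexOf q
  HubOn x (hubCorner q) = x ≡ vertexOf q
  HubOn x _             = ⊥

  hub-on : ∀ {x} k → hub x on k → HubOn x k
  hub-on (hubBridge q) (inj₁ refl)        = refl
  hub-on (hubCorner q) (inj₁ refl)        = refl
  hub-on (face t)      (inj₁ ())
  hub-on (face t)      (inj₂ (inj₁ ()))
  hub-on (face t)      (inj₂ (inj₂ ()))
  hub-on (flap t s)    (inj₁ ())
  hub-on (flap t s)    (inj₂ (inj₁ ()))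
  hub-on (flap t s)    (inj₂ (inj₂ ()))
  hub-on (lid t)       (inj₁ ())
  hub-on (lid t)       (inj₂ (inj₁ ()))
  hub-on (lid t)       (inj₂ (inj₂ ()))
  hub-on (bridge q)    (inj₁ ())
  hub-on (bridge q)    (inj₂ (inj₁ ()))
  hub-on (bridge q)    (inj₂ (inj₂ ()))
  hub-on (hubBridge q) (inj₂ (inj₁ ()))
  hub-on (hubBridge q) (inj₂ (inj₂ ()))
  hub-on (hubCorner q) (inj₂ (inj₁ ()))
  hub-on (hubCorner q) (inj₂ (inj₂ ()))

  old-on-face : ∀ t r → old (corner t r) on face t
  old-on-face t c₀ = ∈▵₁
  old-on-face t c₁ = ∈▵₂
  old-on-face t c₂ = ∈▵₃

  apex-on-lid : ∀ t r → apex t r on lid t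
  apex-on-lid t c₀ = ∈▵₁
  apex-on-lid t c₁ = ∈▵₂
  apex-on-lid t c₂ = ∈▵₃

  old-on-flap : ∀ t {s r} → r ≢ s → old (corner t r) on flap t s
  old-on-flap t r≢s with ≢⇒next⊎prev r≢s
  ... | inj₁ refl = ∈▵₂
  ... | inj₂ refl = ∈▵₃

  InTwo : Vertex → Vertex → Set
  InTwo = InExactlyTwo triangle

  InTwo-sym : ∀ {a b} → InTwo a b → InTwo b a
  InTwo-sym (i , j , i≢j , (a∈i , b∈i) , (a∈j , b∈j) , only) =
    i , j , i≢j , (b∈i , a∈i) , (b∈j , a∈j) , λ k b∈k a∈k → only k a∈k b∈k

  faceEdge-inTwo : ∀ t s → InTwo (old (corner t (next s))) (old (corner t (prev s)))
  faceEdge-inTwo t s = face t , flap t s , (λ ()) , (old-on-face t _ , old-on-face t _) , (∈▵₂ , ∈▵₃) , only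
    where
    only : ∀ k → old (corner t (next s)) on k → old (corner t (prev s)) on k → k ≡ face t ⊎ k ≡ flap t s
    only (face t′) a∈ b∈ with old-on (face t′) a∈ | old-on (face t′) b∈
    ... | _ , e | _ , e′ with refl ← linear (next≢prev s) e e′ = inj₁ refl
    only (flap t′ s′) a∈ b∈ with old-on (flap t′ s′) a∈ | old-on (flap t′ s′) b∈
    ... | _ , ρ≢s′ , e | _ , ρ′≢s′ , e′ with refl ← linear (next≢prev s) e e′ =
      inj₂ (cong (flap t) (≢next∧≢prev⇒≡ (λ s′≡ → ρ≢s′ (trans (sym (corner-injective t e)) (sym s′≡)))
                                         (λ s′≡ → ρ′≢s′ (trans (sym (corner-injective t e′)) (sym s′≡)))))
    only (bridge q) a∈ b∈ =
      ⊥-elim (next≢prev s (corner-injective t (trans (old-on (bridge q) a∈) (sym (old-on (bridge q) b∈)))))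
    only (lid _)       a∈ _ = ⊥-elim (old-on (lid _) a∈)
    only (hubBridge q) a∈ _ = ⊥-elim (old-on (hubBridge q) a∈)
    only (hubCorner q) a∈ _ = ⊥-elim (old-on (hubCorner q) a∈)

  old-apex⁻-inTwo : ∀ q → InTwo (old (vertexOf q)) (apex⁻ q)
  old-apex⁻-inTwo (t , r) = flap t (prev r) , bridge (t , r) , (λ ()) ,
                        (old-on-flap t (λ e → prev-≢ r (sym e)) , ∈▵₁) , (∈▵₁ , ∈▵₂) , only
    where
    only : ∀ k → old (corner t r) on k → apex⁻ (t , r) on k → k ≡ flap t (prev r) ⊎ k ≡ bridge (t , r)
    only (flap t′ s′) _ b∈ with apex-on (flap t′ s′) b∈
    ... | refl , refl = inj₁ refl
    only (bridge (t′ , r′)) a∈ b∈ with apex-on (bridge (t′ , r′)) b∈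
    ... | inj₁ e with refl ← apex-triangle e = inj₂ (cong (λ ρ → bridge (t , ρ)) (prev-injective (sym (apex-corner e))))
    ... | inj₂ e = ⊥-elim (apex⁺≢apex⁻ (trans (σ-vertex (t′ , r′)) (sym (old-on (bridge (t′ , r′)) a∈))) (sym e))
    only (face t′)     _ b∈ = ⊥-elim (apex-on (face t′) b∈)
    only (lid _)       a∈ _ = ⊥-elim (old-on (lid _) a∈)
    only (hubBridge q) a∈ _ = ⊥-elim (old-on (hubBridge q) a∈)
    only (hubCorner q) a∈ _ = ⊥-elim (old-on (hubCorner q) a∈)

  old-apex⁺-inTwo : ∀ q → InTwo (old (vertexOf q)) (apex⁺ q)
  old-apex⁺-inTwo (t , r) = flap t (next r) , bridge (σ⁻¹ (t , r)) , (λ ()) ,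
                        (old-on-flap t (λ e → next-≢ r (sym e)) , ∈▵₁) ,
                        (inj₁ (cong old (sym (σ⁻¹-vertex (t , r)))) , inj₂ (inj₂ (cong apex⁺ (sym (σ-σ⁻¹ (t , r)))))) , only
    where
    only : ∀ k → old (corner t r) on k → apex⁺ (t , r) on k → k ≡ flap t (next r) ⊎ k ≡ bridge (σ⁻¹ (t , r))
    only (flap t′ s′) _ b∈ with apex-on (flap t′ s′) b∈
    ... | refl , refl = inj₁ refl
    only (bridge q′) a∈ b∈ with apex-on (bridge q′) b∈
    ... | inj₁ e = ⊥-elim (apex⁺≢apex⁻ (old-on (bridge q′) a∈) e)
    ... | inj₂ e = inj₂ (cong bridge (trans (sym (σ⁻¹-σ q′)) (cong σ⁻¹ (sym (apex⁺-injective e)))))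
    only (face t′)     _ b∈ = ⊥-elim (apex-on (face t′) b∈)
    only (lid _)       a∈ _ = ⊥-elim (old-on (lid _) a∈)
    only (hubBridge q) a∈ _ = ⊥-elim (old-on (hubBridge q) a∈)
    only (hubCorner q) a∈ _ = ⊥-elim (old-on (hubCorner q) a∈)

  BridgeApex : Vertex → Slot → Set
  BridgeApex v q = v ≡ apex⁻ q ⊎ v ≡ apex⁺ (σ q)

  CornerApex : Vertex → Slot → Set
  CornerApex v q = v ≡ apex⁺ q ⊎ v ≡ apex⁻ q

  bridgeApex-triangle : ∀ {t s t′ s′} q → s ≢ s′ → BridgeApex (apex t s) q → BridgeApex (apex t′ s′) q → t ≢ t′
  bridgeApex-triangle q s≢s′ (inj₁ e) (inj₁ e′) refl = s≢s′ (trans (apex-corner e) (sym (apex-corner e′)))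
  bridgeApex-triangle q _    (inj₁ e) (inj₂ e′) refl = σ-moves q (trans (sym (apex-triangle e′)) (apex-triangle e))
  bridgeApex-triangle q _    (inj₂ e) (inj₁ e′) refl = σ-moves q (trans (sym (apex-triangle e)) (apex-triangle e′))
  bridgeApex-triangle q s≢s′ (inj₂ e) (inj₂ e′) refl = s≢s′ (trans (apex-corner e) (sym (apex-corner e′)))

  cornerApex-triangle : ∀ {t s q} → CornerApex (apex t s) q → t ≡ proj₁ q
  cornerApex-triangle (inj₁ e) = apex-triangle e
  cornerApex-triangle (inj₂ e) = apex-triangle e

  cornerApex-corner : ∀ {t s q} → CornerApex (apex t s) q → proj₂ q ≢ s
  cornerApex-corner (inj₁ e) r≡s = next-≢ _ (trans (sym (apex-corner e)) (sym r≡s))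
  cornerApex-corner (inj₂ e) r≡s = prev-≢ _ (trans (sym (apex-corner e)) (sym r≡s))

  lidEdge-inTwo : ∀ t s → InTwo (apex t (next s)) (apex t (prev s))
  lidEdge-inTwo t s = lid t , hubCorner (t , s) , (λ ()) , (apex-on-lid t _ , apex-on-lid t _) , (∈▵₂ , ∈▵₃) , only
    where
    only : ∀ k → apex t (next s) on k → apex t (prev s) on k → k ≡ lid t ⊎ k ≡ hubCorner (t , s)
    only (flap t′ s′) a∈ b∈ with apex-on (flap t′ s′) a∈ | apex-on (flap t′ s′) b∈
    ... | _ , e | _ , e′ = ⊥-elim (next≢prev s (trans e (sym e′)))
    only (lid t′) a∈ _ with refl ← apex-on (lid t′) a∈ = inj₁ refl
    only (bridge q)    a∈ b∈ = ⊥-elim (bridgeApex-triangle q (next≢prev s) (apex-on (bridge q) a∈) (apex-on (bridge q) b∈) refl)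
    only (hubBridge q) a∈ b∈ = ⊥-elim (bridgeApex-triangle q (next≢prev s) (apex-on (hubBridge q) a∈) (apex-on (hubBridge q) b∈) refl)
    only (hubCorner (t′ , r′)) a∈ b∈ with refl ← cornerApex-triangle (apex-on (hubCorner (t′ , r′)) a∈) =
      inj₂ (cong (λ ρ → hubCorner (t , ρ)) (≢next∧≢prev⇒≡ (cornerApex-corner (apex-on (hubCorner (t , r′)) a∈))
                                                          (cornerApex-corner (apex-on (hubCorner (t , r′)) b∈))))
    only (face t′) a∈ _ = ⊥-elim (apex-on (face t′) a∈)

  bridge-slot : ∀ q q′ → BridgeApex (apex⁻ q) q′ → BridgeApex (apex⁺ (σ q)) q′ → q ≡ q′
  bridge-slot q q′ (inj₁ e) _         = apex⁻-injective e
  bridge-slot q q′ (inj₂ e) (inj₂ e′) = ⊥-elim (apex⁻≢apex⁺σ q (trans e (sym e′)))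
  -- If the two edges cross, linearity puts q and q′ in one triangle, which σ q would then not leave.
  bridge-slot q q′ (inj₂ e) (inj₁ e′) = ⊥-elim (σ-moves q (trans (apex-triangle e′) (sym same-triangle)))
    where
    next-corner : corner (proj₁ q) (next (proj₂ q)) ≡ vertexOf q′
    next-corner = trans (cong₂ corner (apex-triangle e) (sym (prev≡next⇒≡next (apex-corner e)))) (σ-vertex q′)
    own-corner : vertexOf q ≡ corner (proj₁ q′) (next (proj₂ q′))
    own-corner = trans (sym (σ-vertex q)) (cong₂ corner (apex-triangle e′) (prev≡next⇒≡next (sym (apex-corner e′))))
    same-triangle : proj₁ q ≡ proj₁ q′
    same-triangle = linear (next-≢ (proj₂ q)) next-corner own-corner

  bridgeEdge-inTwo : ∀ q → InTwo (apex⁻ q) (apex⁺ (σ q))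
  bridgeEdge-inTwo q = bridge q , hubBridge q , (λ ()) , (∈▵₂ , ∈▵₃) , (∈▵₂ , ∈▵₃) , only
    where
    only : ∀ k → apex⁻ q on k → apex⁺ (σ q) on k → k ≡ bridge q ⊎ k ≡ hubBridge q
    only (bridge q′)    a∈ b∈ = inj₁ (cong bridge (sym (bridge-slot q q′ (apex-on (bridge q′) a∈) (apex-on (bridge q′) b∈))))
    only (hubBridge q′) a∈ b∈ = inj₂ (cong hubBridge (sym (bridge-slot q q′ (apex-on (hubBridge q′) a∈) (apex-on (hubBridge q′) b∈))))
    only (flap t′ s′) a∈ b∈ with apex-on (flap t′ s′) a∈ | apex-on (flap t′ s′) b∈
    ... | e , _ | e′ , _ = ⊥-elim (σ-moves q (trans e′ (sym e)))
    only (lid t′) a∈ b∈ = ⊥-elim (σ-moves q (trans (apex-on (lid t′) b∈) (sym (apex-on (lid t′) a∈))))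
    only (hubCorner q′) a∈ b∈ =
      ⊥-elim (σ-moves q (trans (cornerApex-triangle (apex-on (hubCorner q′) b∈)) (sym (cornerApex-triangle (apex-on (hubCorner q′) a∈)))))
    only (face t′) a∈ _ = ⊥-elim (apex-on (face t′) a∈)

  hub-apex⁺-inTwo : ∀ q → InTwo (hub (vertexOf q)) (apex⁺ q)
  hub-apex⁺-inTwo q = hubCorner q , hubBridge (σ⁻¹ q) , (λ ()) , (∈▵₁ , ∈▵₂) ,
                      (inj₁ (cong hub (sym (σ⁻¹-vertex q))) , inj₂ (inj₂ (cong apex⁺ (sym (σ-σ⁻¹ q))))) , only
    where
    only : ∀ k → hub (vertexOf q) on k → apex⁺ q on k → k ≡ hubCorner q ⊎ k ≡ hubBridge (σ⁻¹ q)
    only (hubBridge q′) a∈ b∈ with apex-on (hubBridge q′) b∈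
    ... | inj₁ e = ⊥-elim (apex⁺≢apex⁻ (hub-on (hubBridge q′) a∈) e)
    ... | inj₂ e = inj₂ (cong hubBridge (trans (sym (σ⁻¹-σ q′)) (cong σ⁻¹ (sym (apex⁺-injective e)))))
    only (hubCorner q′) a∈ b∈ with apex-on (hubCorner q′) b∈
    ... | inj₁ e = inj₁ (cong hubCorner (sym (apex⁺-injective e)))
    ... | inj₂ e = ⊥-elim (apex⁺≢apex⁻ (hub-on (hubCorner q′) a∈) e)
    only (face t′)   a∈ _ = ⊥-elim (hub-on (face t′) a∈)
    only (flap t′ _) a∈ _ = ⊥-elim (hub-on (flap t′ _) a∈)
    only (lid t′)    a∈ _ = ⊥-elim (hub-on (lid t′) a∈)
    only (bridge q′) a∈ _ = ⊥-elim (hub-on (bridge q′) a∈)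

  hub-apex⁻-inTwo : ∀ q → InTwo (hub (vertexOf q)) (apex⁻ q)
  hub-apex⁻-inTwo q = hubCorner q , hubBridge q , (λ ()) , (∈▵₁ , ∈▵₃) , (∈▵₁ , ∈▵₂) , only
    where
    only : ∀ k → hub (vertexOf q) on k → apex⁻ q on k → k ≡ hubCorner q ⊎ k ≡ hubBridge q
    only (hubBridge q′) a∈ b∈ with apex-on (hubBridge q′) b∈
    ... | inj₁ e = inj₂ (cong hubBridge (sym (apex⁻-injective e)))
    ... | inj₂ e = ⊥-elim (apex⁺≢apex⁻ (trans (σ-vertex q′) (sym (hub-on (hubBridge q′) a∈))) (sym e))
    only (hubCorner q′) a∈ b∈ with apex-on (hubCorner q′) b∈
    ... | inj₁ e = ⊥-elim (apex⁺≢apex⁻ (sym (hub-on (hubCorner q′) a∈)) (sym e))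
    ... | inj₂ e = inj₁ (cong hubCorner (sym (apex⁻-injective e)))
    only (face t′)   a∈ _ = ⊥-elim (hub-on (face t′) a∈)
    only (flap t′ _) a∈ _ = ⊥-elim (hub-on (flap t′ _) a∈)
    only (lid t′)    a∈ _ = ⊥-elim (hub-on (lid t′) a∈)
    only (bridge q′) a∈ _ = ⊥-elim (hub-on (bridge q′) a∈)

  sides-inTwo : ∀ k → Sides InTwo (triangle k)
  sides-inTwo (face t) = faceEdge-inTwo t c₂ , InTwo-sym (faceEdge-inTwo t c₁) , faceEdge-inTwo t c₀
  sides-inTwo (flap t s) =
    InTwo-sym (subst (λ ρ → InTwo (old (corner t (next s))) (apex t ρ)) (prev-next s) (old-apex⁻-inTwo (t , next s))) ,
    InTwo-sym (subst (λ ρ → InTwo (old (corner t (prev s))) (apex t ρ)) (next-prev s) (old-apex⁺-inTwo (t , prev s))) ,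
    faceEdge-inTwo t s
  sides-inTwo (lid t) = lidEdge-inTwo t c₂ , InTwo-sym (lidEdge-inTwo t c₁) , lidEdge-inTwo t c₀
  sides-inTwo (bridge q) =
    old-apex⁻-inTwo q ,
    subst (λ x → InTwo (old x) (apex⁺ (σ q))) (σ-vertex q) (old-apex⁺-inTwo (σ q)) ,
    bridgeEdge-inTwo q
  sides-inTwo (hubBridge q) =
    hub-apex⁻-inTwo q ,
    subst (λ x → InTwo (hub x) (apex⁺ (σ q))) (σ-vertex q) (hub-apex⁺-inTwo (σ q)) ,
    bridgeEdge-inTwo q
  sides-inTwo (hubCorner q) = hub-apex⁺-inTwo q , hub-apex⁻-inTwo q , lidEdge-inTwo (proj₁ q) (proj₂ q)

  edge-inTwo : ∀ a b → EdgeOf′ triangle a b → InTwo a b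
  edge-inTwo a b (a≢b , k , a∈ , b∈) = Sides-lookup InTwo-sym (sides-inTwo k) a∈ b∈ a≢b

  old-corner-≢ : ∀ t {r r′} → r ≢ r′ → old (corner t r) ≢ old (corner t r′)
  old-corner-≢ t r≢r′ e = r≢r′ (corner-injective t (old-injective e))

  apex-≢ : ∀ t {r r′} → r ≢ r′ → apex t r ≢ apex t r′
  apex-≢ t r≢r′ e = r≢r′ (apex-corner e)

  sides-distinct : ∀ k → Sides _≢_ (triangle k)
  sides-distinct (face t)      = old-corner-≢ t (λ ()) , old-corner-≢ t (λ ()) , old-corner-≢ t (λ ())
  sides-distinct (flap t s)    = (λ ()) , (λ ()) , old-corner-≢ t (next≢prev s)
  sides-distinct (lid t)       = apex-≢ t (λ ()) , apex-≢ t (λ ()) , apex-≢ t (λ ())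
  sides-distinct (bridge q)    = (λ ()) , (λ ()) , apex⁻≢apex⁺σ q
  sides-distinct (hubBridge q) = (λ ()) , (λ ()) , apex⁻≢apex⁺σ q
  sides-distinct (hubCorner q) = (λ ()) , (λ ()) , apex⁺≢apex⁻ refl

  slotAt : V → Slot
  slotAt x = star x zero

  slotAt-vertex : ∀ x → vertexOf (slotAt x) ≡ x
  slotAt-vertex x = star-corner x zero

  on-some-triangle : ∀ v → ∃[ k ] (v on k)
  on-some-triangle (old x)    = bridge (slotAt x) , inj₁ (cong old (sym (slotAt-vertex x)))
  on-some-triangle (apex t r) = lid t , apex-on-lid t r
  on-some-triangle (hub x)    = hubCorner (slotAt x) , inj₁ (cong hub (sym (slotAt-vertex x)))

  open SameVertices

  bridge-determined : ∀ {q q′} → vertexOf q ≡ vertexOf q′ → BridgeApex (apex⁻ q) q′ → q ≡ q′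
  bridge-determined _    (inj₁ e) = apex⁻-injective e
  bridge-determined same (inj₂ e) = ⊥-elim (apex⁺≢apex⁻ (trans (σ-vertex _) (sym same)) (sym e))

  hubCorner-determined : ∀ {q q′} → vertexOf q ≡ vertexOf q′ → CornerApex (apex⁺ q) q′ → q ≡ q′
  hubCorner-determined _    (inj₁ e) = apex⁺-injective e
  hubCorner-determined same (inj₂ e) = ⊥-elim (apex⁺≢apex⁻ same e)

  flap≢bridge : ∀ {t s q} → old (corner t (next s)) on bridge q → old (corner t (prev s)) on bridge q → ⊥
  flap≢bridge {t} {s} {q} a∈ b∈ =
    next≢prev s (corner-injective t (trans (old-on (bridge q) a∈) (sym (old-on (bridge q) b∈))))

  hubBridge≢hubCorner : ∀ {q q′} → apex⁻ q on hubCorner q′ → apex⁺ (σ q) on hubCorner q′ → ⊥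
  hubBridge≢hubCorner {q} {q′} a∈ b∈ =
    σ-moves q (trans (cornerApex-triangle (apex-on (hubCorner q′) b∈)) (sym (cornerApex-triangle (apex-on (hubCorner q′) a∈))))

  same-vertices⇒≡ : ∀ i j → SameVertices triangle i j → i ≡ j
  same-vertices⇒≡ (face t) (face t′) same with old-on (face t′) (fwd same ∈▵₁) | old-on (face t′) (fwd same ∈▵₂)
  ... | _ , e | _ , e′ = cong face (linear (λ ()) e e′)
  same-vertices⇒≡ (flap t s) (flap t′ s′) same with apex-on {t} {s} (flap t′ s′) (fwd same ∈▵₁)
  ... | refl , refl = refl
  same-vertices⇒≡ (lid t) (lid t′) same = cong lid (apex-on (lid t′) (fwd same ∈▵₁))
  same-vertices⇒≡ (bridge q) (bridge q′) same =
    cong bridge (bridge-determined (old-on (bridge q′) (fwd same ∈▵₁)) (apex-on (bridge q′) (fwd same ∈▵₂)))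
  same-vertices⇒≡ (hubBridge q) (hubBridge q′) same =
    cong hubBridge (bridge-determined (hub-on (hubBridge q′) (fwd same ∈▵₁)) (apex-on (hubBridge q′) (fwd same ∈▵₂)))
  same-vertices⇒≡ (hubCorner q) (hubCorner q′) same =
    cong hubCorner (hubCorner-determined (hub-on (hubCorner q′) (fwd same ∈▵₁)) (apex-on (hubCorner q′) (fwd same ∈▵₂)))
  same-vertices⇒≡ (flap t s) (bridge q) same = ⊥-elim (flap≢bridge (fwd same ∈▵₂) (fwd same ∈▵₃))
  same-vertices⇒≡ (bridge q) (flap t s) same = ⊥-elim (flap≢bridge (bwd same ∈▵₂) (bwd same ∈▵₃))
  same-vertices⇒≡ (hubBridge q) (hubCorner q′) same = ⊥-elim (hubBridge≢hubCorner (fwd same ∈▵₂) (fwd same ∈▵₃))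
  same-vertices⇒≡ (hubCorner q′) (hubBridge q) same = ⊥-elim (hubBridge≢hubCorner (bwd same ∈▵₂) (bwd same ∈▵₃))
  same-vertices⇒≡ (face t)      (flap t′ s′)   same = ⊥-elim (apex-on (face t) (bwd same ∈▵₁))
  same-vertices⇒≡ (face t)      (lid t′)       same = ⊥-elim (apex-on (face t) (bwd same ∈▵₁))
  same-vertices⇒≡ (face t)      (bridge q′)    same = ⊥-elim (apex-on (face t) (bwd same ∈▵₂))
  same-vertices⇒≡ (face t)      (hubBridge q′) same = ⊥-elim (hub-on (face t) (bwd same ∈▵₁))
  same-vertices⇒≡ (face t)      (hubCorner q′) same = ⊥-elim (hub-on (face t) (bwd same ∈▵₁))
  same-vertices⇒≡ (flap t s)    (face t′)      same = ⊥-elim (apex-on (face t′) (fwd same ∈▵₁))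
  same-vertices⇒≡ (flap t s)    (lid t′)       same = ⊥-elim (old-on (lid t′) (fwd same ∈▵₂))
  same-vertices⇒≡ (flap t s)    (hubBridge q′) same = ⊥-elim (old-on (hubBridge q′) (fwd same ∈▵₂))
  same-vertices⇒≡ (flap t s)    (hubCorner q′) same = ⊥-elim (old-on (hubCorner q′) (fwd same ∈▵₂))
  same-vertices⇒≡ (lid t)       (face t′)      same = ⊥-elim (apex-on (face t′) (fwd same ∈▵₁))
  same-vertices⇒≡ (lid t)       (flap t′ s′)   same = ⊥-elim (old-on (lid t) (bwd same ∈▵₂))
  same-vertices⇒≡ (lid t)       (bridge q′)    same = ⊥-elim (old-on (lid t) (bwd same ∈▵₁))
  same-vertices⇒≡ (lid t)       (hubBridge q′) same = ⊥-elim (hub-on (lid t) (bwd same ∈▵₁))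
  same-vertices⇒≡ (lid t)       (hubCorner q′) same = ⊥-elim (hub-on (lid t) (bwd same ∈▵₁))
  same-vertices⇒≡ (bridge q)    (face t′)      same = ⊥-elim (apex-on (face t′) (fwd same ∈▵₂))
  same-vertices⇒≡ (bridge q)    (lid t′)       same = ⊥-elim (old-on (lid t′) (fwd same ∈▵₁))
  same-vertices⇒≡ (bridge q)    (hubBridge q′) same = ⊥-elim (hub-on (bridge q) (bwd same ∈▵₁))
  same-vertices⇒≡ (bridge q)    (hubCorner q′) same = ⊥-elim (hub-on (bridge q) (bwd same ∈▵₁))
  same-vertices⇒≡ (hubBridge q) (face t′)      same = ⊥-elim (hub-on (face t′) (fwd same ∈▵₁))
  same-vertices⇒≡ (hubBridge q) (flap t′ s′)   same = ⊥-elim (hub-on (flap t′ s′) (fwd same ∈▵₁))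
  same-vertices⇒≡ (hubBridge q) (lid t′)       same = ⊥-elim (hub-on (lid t′) (fwd same ∈▵₁))
  same-vertices⇒≡ (hubBridge q) (bridge q′)    same = ⊥-elim (hub-on (bridge q′) (fwd same ∈▵₁))
  same-vertices⇒≡ (hubCorner q) (face t′)      same = ⊥-elim (hub-on (face t′) (fwd same ∈▵₁))
  same-vertices⇒≡ (hubCorner q) (flap t′ s′)   same = ⊥-elim (hub-on (flap t′ s′) (fwd same ∈▵₁))
  same-vertices⇒≡ (hubCorner q) (lid t′)       same = ⊥-elim (hub-on (lid t′) (fwd same ∈▵₁))
  same-vertices⇒≡ (hubCorner q) (bridge q′)    same = ⊥-elim (hub-on (bridge q′) (fwd same ∈▵₁))

  Edge : Vertex → Vertex → Set
  Edge = EdgeOf′ triangle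

  old-edge : ∀ {x y} → Adjacent corner x y → Edge (old x) (old y)
  old-edge (t , r , r′ , r≢r′ , refl , refl) = old-corner-≢ t r≢r′ , face t , old-on-face t r , old-on-face t r′

  nearbyOld : Vertex → V
  nearbyOld (old x)    = x
  nearbyOld (apex t s) = corner t (next s)
  nearbyOld (hub x)    = nearbyOld (apex⁺ (slotAt x))

  to-nearbyOld : ∀ v → Star Edge v (old (nearbyOld v))
  to-nearbyOld (old x)    = ε
  to-nearbyOld (apex t s) = ((λ ()) , flap t s , ∈▵₁ , ∈▵₂) ◅ ε
  to-nearbyOld (hub x)    = ((λ ()) , hubCorner (slotAt x) , inj₁ (cong hub (sym (slotAt-vertex x))) , ∈▵₂) ◅ ε
                            ◅◅ to-nearbyOld (apex⁺ (slotAt x))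

  connectedSurface : ∀ u w → Star Edge u w
  connectedSurface u w =
    to-nearbyOld u ◅◅ gmap old old-edge (connected (nearbyOld u) (nearbyOld w)) ◅◅ reverse (EdgeOf′-sym triangle) (to-nearbyOld w)

  Link : Vertex → Vertex → Vertex → Set
  Link = LinkAdj′ triangle

  link-via : ∀ {v a b} k → v on k → a on k → b on k → a ≢ b → a ≢ v → b ≢ v → Link v a b
  link-via k v∈ a∈ b∈ a≢b a≢v b≢v = a≢b , a≢v , b≢v , k , v∈ , a∈ , b∈

  Fan : (V → Vertex) → Set
  Fan centre = ∀ q → Star (Link (centre (vertexOf q))) (apex⁺ q) (apex⁺ (σ q))

  around-fans : ∀ {centre} → Fan centre → ∀ q → Star (Link (centre (vertexOf q))) (apex⁺ (slotAt (vertexOf q))) (apex⁺ q)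
  around-fans {centre} fan q =
    subst (λ p → Star (Link (centre x)) (apex⁺ (slotAt x)) (apex⁺ p)) (star-position q)
          (cyclic-reach (LinkAdj′-sym triangle) (λ k → apex⁺ (star x k)) fan-at (position q))
    where
    x : V
    x = vertexOf q
    fan-at : ∀ k → Star (Link (centre x)) (apex⁺ (star x k)) (apex⁺ (star x (next k)))
    fan-at k = subst₂ (λ y p → Star (Link (centre y)) (apex⁺ (star x k)) (apex⁺ p)) (star-corner x k) (σ-star x k) (fan (star x k))

  module OldFan (t : T) (r : Corner) where

    step₁ : Link (old (corner t r)) (apex t (next r)) (old (corner t (prev r)))
    step₁ = link-via (flap t (next r)) (old-on-flap t (λ e → next-≢ r (sym e))) ∈▵₁ (old-on-flap t (λ e → next≢prev r (sym e)))
                     (λ ()) (λ ()) (old-corner-≢ t (prev-≢ r))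

    step₂ : Link (old (corner t r)) (old (corner t (prev r))) (old (corner t (next r)))
    step₂ = link-via (face t) (old-on-face t r) (old-on-face t (prev r)) (old-on-face t (next r))
                     (old-corner-≢ t (λ e → next≢prev r (sym e))) (old-corner-≢ t (prev-≢ r)) (old-corner-≢ t (next-≢ r))

    step₃ : Link (old (corner t r)) (old (corner t (next r))) (apex t (prev r))
    step₃ = link-via (flap t (prev r)) (old-on-flap t (λ e → prev-≢ r (sym e))) (old-on-flap t (next≢prev r)) ∈▵₁
                     (λ ()) (old-corner-≢ t (next-≢ r)) (λ ())

    step₄ : Link (old (corner t r)) (apex t (prev r)) (apex⁺ (σ (t , r)))
    step₄ = link-via (bridge (t , r)) ∈▵₁ ∈▵₂ ∈▵₃ (apex⁻≢apex⁺σ (t , r)) (λ ()) (λ ())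

  old-fan : Fan old
  old-fan (t , r) = step₁ ◅ step₂ ◅ step₃ ◅ step₄ ◅ ε
    where open OldFan t r

  FromSlot : (V → Vertex) → V → Vertex → Set
  FromSlot centre x a = ∃[ q ] (vertexOf q ≡ x × Star (Link (centre x)) (apex⁺ q) a)

  on-face⁻ : ∀ {a t} → a on face t → ∃[ ρ ] (a ≡ old (corner t ρ))
  on-face⁻ (inj₁ e)        = c₀ , e
  on-face⁻ (inj₂ (inj₁ e)) = c₁ , e
  on-face⁻ (inj₂ (inj₂ e)) = c₂ , e

  on-lid⁻ : ∀ {a t} → a on lid t → ∃[ ρ ] (a ≡ apex t ρ)
  on-lid⁻ (inj₁ e)        = c₀ , e
  on-lid⁻ (inj₂ (inj₁ e)) = c₁ , e
  on-lid⁻ (inj₂ (inj₂ e)) = c₂ , e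

  old-neighbour : ∀ x a k → old x on k → a on k → a ≢ old x → FromSlot old x a
  old-neighbour x a (face t) x∈ a∈ a≢x with old-on (face t) x∈ | on-face⁻ a∈
  ... | ρ , refl | ρ′ , refl with ≢⇒next⊎prev {ρ} {ρ′} (λ e → a≢x (cong (λ r → old (corner t r)) e))
  ...   | inj₁ refl = (t , ρ) , refl , step₁ ◅ step₂ ◅ ε where open OldFan t ρ
  ...   | inj₂ refl = (t , ρ) , refl , step₁ ◅ ε where open OldFan t ρ
  old-neighbour x a (flap t s) x∈ a∈ a≢x with old-on (flap t s) x∈
  ... | ρ , ρ≢s , refl with ≢⇒next⊎prev ρ≢s | a∈
  ...   | inj₁ refl | inj₁ refl =
    (t , next s) , refl , subst (Star _ _) (cong (apex t) (prev-next s)) (step₁ ◅ step₂ ◅ step₃ ◅ ε)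
    where open OldFan t (next s)
  ...   | inj₂ refl | inj₁ refl = (t , prev s) , refl , subst (Star _ _) (cong (apex t) (next-prev s)) ε
  ...   | inj₁ refl | inj₂ (inj₁ refl) = ⊥-elim (a≢x refl)
  ...   | inj₂ refl | inj₂ (inj₁ refl) =
    (t , prev s) , refl , subst (Star _ _) (cong (λ r → old (corner t r)) (prev-prev s)) (step₁ ◅ ε)
    where open OldFan t (prev s)
  ...   | inj₁ refl | inj₂ (inj₂ refl) =
    (t , next s) , refl , subst (Star _ _) (cong (λ r → old (corner t r)) (next-next s)) (step₁ ◅ step₂ ◅ ε)
    where open OldFan t (next s)
  ...   | inj₂ refl | inj₂ (inj₂ refl) = ⊥-elim (a≢x refl)
  old-neighbour x a (bridge (t , r)) x∈ a∈ a≢x with old-on (bridge (t , r)) x∈ | a∈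
  ... | refl | inj₁ refl        = ⊥-elim (a≢x refl)
  ... | refl | inj₂ (inj₁ refl) = (t , r) , refl , step₁ ◅ step₂ ◅ step₃ ◅ ε where open OldFan t r
  ... | refl | inj₂ (inj₂ refl) = (t , r) , refl , old-fan (t , r)
  old-neighbour x a (lid t)       x∈ _ _ = ⊥-elim (old-on (lid t) x∈)
  old-neighbour x a (hubBridge q) x∈ _ _ = ⊥-elim (old-on (hubBridge q) x∈)
  old-neighbour x a (hubCorner q) x∈ _ _ = ⊥-elim (old-on (hubCorner q) x∈)

  hub-step₁ : ∀ q → Link (hub (vertexOf q)) (apex⁺ q) (apex⁻ q)
  hub-step₁ q = link-via (hubCorner q) ∈▵₁ ∈▵₂ ∈▵₃ (apex⁺≢apex⁻ refl) (λ ()) (λ ())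

  hub-step₂ : ∀ q → Link (hub (vertexOf q)) (apex⁻ q) (apex⁺ (σ q))
  hub-step₂ q = link-via (hubBridge q) ∈▵₁ ∈▵₂ ∈▵₃ (apex⁻≢apex⁺σ q) (λ ()) (λ ())

  hub-fan : Fan hub
  hub-fan q = hub-step₁ q ◅ hub-step₂ q ◅ ε

  hub-neighbour : ∀ x a k → hub x on k → a on k → a ≢ hub x → FromSlot hub x a
  hub-neighbour x a (hubBridge q) x∈ a∈ a≢x with hub-on (hubBridge q) x∈ | a∈
  ... | refl | inj₁ refl        = ⊥-elim (a≢x refl)
  ... | refl | inj₂ (inj₁ refl) = q , refl , hub-step₁ q ◅ ε
  ... | refl | inj₂ (inj₂ refl) = q , refl , hub-fan q
  hub-neighbour x a (hubCorner q) x∈ a∈ a≢x with hub-on (hubCorner q) x∈ | a∈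
  ... | refl | inj₁ refl        = ⊥-elim (a≢x refl)
  ... | refl | inj₂ (inj₁ refl) = q , refl , ε
  ... | refl | inj₂ (inj₂ refl) = q , refl , hub-step₁ q ◅ ε
  hub-neighbour x a (face t)     x∈ _ _ = ⊥-elim (hub-on (face t) x∈)
  hub-neighbour x a (flap t s)   x∈ _ _ = ⊥-elim (hub-on (flap t s) x∈)
  hub-neighbour x a (lid t)      x∈ _ _ = ⊥-elim (hub-on (lid t) x∈)
  hub-neighbour x a (bridge q)   x∈ _ _ = ⊥-elim (hub-on (bridge q) x∈)

  centre-link : (centre : V → Vertex) → Fan centre → (∀ x a k → centre x on k → a on k → a ≢ centre x → FromSlot centre x a) →
                ∀ x a → Edge (centre x) a → Star (Link (centre x)) (apex⁺ (slotAt x)) a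
  centre-link centre fan neighbour x a (x≢a , k , x∈ , a∈) with neighbour x a k x∈ a∈ (λ e → x≢a (sym e))
  ... | q , refl , q⇝a = around-fans {centre} fan q ◅◅ q⇝a

  apex⁻-slot : ∀ {t s} p → apex t s ≡ apex⁻ p → p ≡ (t , next s)
  apex⁻-slot (_ , r) e = cong₂ _,_ (sym (apex-triangle e)) (trans (sym (next-prev r)) (cong next (sym (apex-corner e))))

  apex⁺-slot : ∀ {t s} p → apex t s ≡ apex⁺ p → p ≡ (t , prev s)
  apex⁺-slot (_ , r) e = cong₂ _,_ (sym (apex-triangle e)) (trans (sym (prev-next r)) (cong prev (sym (apex-corner e))))

  module ApexLink (t : T) (s : Corner) where

    u : Vertex
    u = apex t s

    x₁ x₂ : V
    x₁ = corner t (next s)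
    x₂ = corner t (prev s)

    q₁ q₂ p₂ : Slot
    q₁ = (t , next s)
    q₂ = (t , prev s)
    p₂ = σ⁻¹ q₂

    apex⁻q₁ : apex⁻ q₁ ≡ u
    apex⁻q₁ = cong (apex t) (prev-next s)

    apex⁺q₂ : apex⁺ q₂ ≡ u
    apex⁺q₂ = cong (apex t) (next-prev s)

    apex⁺σp₂ : apex⁺ (σ p₂) ≡ u
    apex⁺σp₂ = trans (cong apex⁺ (σ-σ⁻¹ q₂)) apex⁺q₂

    p₂-vertex : vertexOf p₂ ≡ x₂
    p₂-vertex = σ⁻¹-vertex q₂

    l₁ : Link u (old x₁) (old x₂)
    l₁ = link-via (flap t s) ∈▵₁ ∈▵₂ ∈▵₃ (old-corner-≢ t (next≢prev s)) (λ ()) (λ ())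

    l₂ : Link u (old x₂) (apex⁻ p₂)
    l₂ = link-via (bridge p₂) (inj₂ (inj₂ (sym apex⁺σp₂))) (inj₁ (cong old (sym p₂-vertex))) ∈▵₂
                  (λ ()) (λ ()) (λ e → apex⁻≢apex⁺σ p₂ (trans e (sym apex⁺σp₂)))

    l₃ : Link u (apex⁻ p₂) (hub x₂)
    l₃ = link-via (hubBridge p₂) (inj₂ (inj₂ (sym apex⁺σp₂))) ∈▵₂ (inj₁ (cong hub (sym p₂-vertex)))
                  (λ ()) (λ e → apex⁻≢apex⁺σ p₂ (trans e (sym apex⁺σp₂))) (λ ())

    l₄ : Link u (hub x₂) (apex t (next s))
    l₄ = link-via (hubCorner q₂) (inj₂ (inj₁ (sym apex⁺q₂))) ∈▵₁ (inj₂ (inj₂ (cong (apex t) (sym (prev-prev s)))))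
                  (λ ()) (λ ()) (apex-≢ t (next-≢ s))

    l₅ : Link u (apex t (next s)) (apex t (prev s))
    l₅ = link-via (lid t) (apex-on-lid t s) (apex-on-lid t (next s)) (apex-on-lid t (prev s))
                  (apex-≢ t (next≢prev s)) (apex-≢ t (next-≢ s)) (apex-≢ t (prev-≢ s))

    l₆ : Link u (apex t (prev s)) (hub x₁)
    l₆ = link-via (hubCorner q₁) (inj₂ (inj₂ (sym apex⁻q₁))) (inj₂ (inj₁ (cong (apex t) (sym (next-next s))))) ∈▵₁
                  (λ ()) (apex-≢ t (prev-≢ s)) (λ ())

    l₇ : Link u (hub x₁) (apex⁺ (σ q₁))
    l₇ = link-via (hubBridge q₁) (inj₂ (inj₁ (sym apex⁻q₁))) ∈▵₁ ∈▵₃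
                  (λ ()) (λ ()) (λ e → apex⁻≢apex⁺σ q₁ (trans apex⁻q₁ (sym e)))

    neighbour : ∀ a k → u on k → a on k → a ≢ u → Star (Link u) (old x₁) a
    neighbour a (flap t′ s′) u∈ a∈ a≢u with apex-on (flap t′ s′) u∈ | a∈
    ... | refl , refl | inj₁ refl        = ⊥-elim (a≢u refl)
    ... | refl , refl | inj₂ (inj₁ refl) = ε
    ... | refl , refl | inj₂ (inj₂ refl) = l₁ ◅ ε
    neighbour a (lid t′) u∈ a∈ a≢u with refl ← apex-on (lid t′) u∈ with on-lid⁻ a∈
    ... | ρ , refl with ≢⇒next⊎prev {s} {ρ} (λ e → a≢u (cong (apex t) e))
    ...   | inj₁ refl = l₁ ◅ l₂ ◅ l₃ ◅ l₄ ◅ ε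
    ...   | inj₂ refl = l₁ ◅ l₂ ◅ l₃ ◅ l₄ ◅ l₅ ◅ ε
    neighbour a (bridge p) u∈ a∈ a≢u with apex-on (bridge p) u∈
    ... | inj₁ e with refl ← apex⁻-slot p e with a∈
    ...   | inj₁ refl        = ε
    ...   | inj₂ (inj₁ refl) = ⊥-elim (a≢u (sym e))
    ...   | inj₂ (inj₂ refl) = l₁ ◅ l₂ ◅ l₃ ◅ l₄ ◅ l₅ ◅ l₆ ◅ l₇ ◅ ε
    neighbour a (bridge p) u∈ a∈ a≢u | inj₂ e with refl ← trans (sym (σ⁻¹-σ p)) (cong σ⁻¹ (apex⁺-slot (σ p) e)) with a∈
    ...   | inj₁ refl        = subst (Star (Link u) (old x₁)) (cong old (sym p₂-vertex)) (l₁ ◅ ε)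
    ...   | inj₂ (inj₁ refl) = l₁ ◅ l₂ ◅ ε
    ...   | inj₂ (inj₂ refl) = ⊥-elim (a≢u (sym e))
    neighbour a (hubBridge p) u∈ a∈ a≢u with apex-on (hubBridge p) u∈
    ... | inj₁ e with refl ← apex⁻-slot p e with a∈
    ...   | inj₁ refl        = l₁ ◅ l₂ ◅ l₃ ◅ l₄ ◅ l₅ ◅ l₆ ◅ ε
    ...   | inj₂ (inj₁ refl) = ⊥-elim (a≢u (sym e))
    ...   | inj₂ (inj₂ refl) = l₁ ◅ l₂ ◅ l₃ ◅ l₄ ◅ l₅ ◅ l₆ ◅ l₇ ◅ ε
    neighbour a (hubBridge p) u∈ a∈ a≢u | inj₂ e with refl ← trans (sym (σ⁻¹-σ p)) (cong σ⁻¹ (apex⁺-slot (σ p) e)) with a∈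
    ...   | inj₁ refl        = subst (Star (Link u) (old x₁)) (cong hub (sym p₂-vertex)) (l₁ ◅ l₂ ◅ l₃ ◅ ε)
    ...   | inj₂ (inj₁ refl) = l₁ ◅ l₂ ◅ ε
    ...   | inj₂ (inj₂ refl) = ⊥-elim (a≢u (sym e))
    neighbour a (hubCorner p) u∈ a∈ a≢u with apex-on (hubCorner p) u∈
    ... | inj₁ e with refl ← apex⁺-slot p e with a∈
    ...   | inj₁ refl        = l₁ ◅ l₂ ◅ l₃ ◅ ε
    ...   | inj₂ (inj₁ refl) = ⊥-elim (a≢u (sym e))
    ...   | inj₂ (inj₂ refl) = subst (Star (Link u) (old x₁)) (cong (apex t) (sym (prev-prev s))) (l₁ ◅ l₂ ◅ l₃ ◅ l₄ ◅ ε)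
    neighbour a (hubCorner p) u∈ a∈ a≢u | inj₂ e with refl ← apex⁻-slot p e with a∈
    ...   | inj₁ refl        = l₁ ◅ l₂ ◅ l₃ ◅ l₄ ◅ l₅ ◅ l₆ ◅ ε
    ...   | inj₂ (inj₁ refl) = subst (Star (Link u) (old x₁)) (cong (apex t) (sym (next-next s))) (l₁ ◅ l₂ ◅ l₃ ◅ l₄ ◅ l₅ ◅ ε)
    ...   | inj₂ (inj₂ refl) = ⊥-elim (a≢u (sym e))
    neighbour a (face t′) u∈ _ _ = ⊥-elim (apex-on (face t′) u∈)

  linkBase : Vertex → Vertex
  linkBase (old x)    = apex⁺ (slotAt x)
  linkBase (apex t s) = old (corner t (next s))
  linkBase (hub x)    = apex⁺ (slotAt x)

  link-from-base : ∀ v a → Edge v a → Star (Link v) (linkBase v) a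
  link-from-base (old x)    = centre-link old old-fan old-neighbour x
  link-from-base (hub x)    = centre-link hub hub-fan hub-neighbour x
  link-from-base (apex t s) a (u≢a , k , u∈ , a∈) = ApexLink.neighbour t s a k u∈ a∈ (λ e → u≢a (sym e))

  isClosedSurface : IsClosedSurface′ triangle
  isClosedSurface = record
    { someTriangle = face t₀
    ; distinctVert = sides-distinct
    ; distinctTri  = same-vertices⇒≡
    ; allVertices  = on-some-triangle
    ; edgeTwo      = edge-inTwo
    ; linkConn     = λ v a b va vb → reverse (LinkAdj′-sym triangle) (link-from-base v a va) ◅◅ link-from-base v b vb
    ; connected    = connectedSurface
    }

  Vertex↔ : Vertex ↔ (V ⊎ Slot ⊎ V)
  Vertex↔ = mk↔ₛ′ to from (λ { (inj₁ _) → refl ; (inj₂ (inj₁ _)) → refl ; (inj₂ (inj₂ _)) → refl })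
                          (λ { (old _) → refl ; (apex _ _) → refl ; (hub _) → refl })
    where
    to : Vertex → V ⊎ Slot ⊎ V
    to (old x)    = inj₁ x
    to (apex t r) = inj₂ (inj₁ (t , r))
    to (hub x)    = inj₂ (inj₂ x)
    from : V ⊎ Slot ⊎ V → Vertex
    from (inj₁ x)             = old x
    from (inj₂ (inj₁ (t , r))) = apex t r
    from (inj₂ (inj₂ x))      = hub x

  Triangle↔ : Triangle ↔ (T ⊎ Slot ⊎ T ⊎ Slot ⊎ Slot ⊎ Slot)
  Triangle↔ = mk↔ₛ′ to from
    (λ { (inj₁ _) → refl ; (inj₂ (inj₁ _)) → refl ; (inj₂ (inj₂ (inj₁ _))) → refl ; (inj₂ (inj₂ (inj₂ (inj₁ _)))) → refl
       ; (inj₂ (inj₂ (inj₂ (inj₂ (inj₁ _))))) → refl ; (inj₂ (inj₂ (inj₂ (inj₂ (inj₂ _))))) → refl })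
    (λ { (face _) → refl ; (flap _ _) → refl ; (lid _) → refl ; (bridge _) → refl ; (hubBridge _) → refl ; (hubCorner _) → refl })
    where
    to : Triangle → T ⊎ Slot ⊎ T ⊎ Slot ⊎ Slot ⊎ Slot
    to (face t)      = inj₁ t
    to (flap t r)    = inj₂ (inj₁ (t , r))
    to (lid t)       = inj₂ (inj₂ (inj₁ t))
    to (bridge q)    = inj₂ (inj₂ (inj₂ (inj₁ q)))
    to (hubBridge q) = inj₂ (inj₂ (inj₂ (inj₂ (inj₁ q))))
    to (hubCorner q) = inj₂ (inj₂ (inj₂ (inj₂ (inj₂ q))))
    from : T ⊎ Slot ⊎ T ⊎ Slot ⊎ Slot ⊎ Slot → Triangle
    from (inj₁ t)                               = face t
    from (inj₂ (inj₁ (t , r)))                  = flap t r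
    from (inj₂ (inj₂ (inj₁ t)))                 = lid t
    from (inj₂ (inj₂ (inj₂ (inj₁ q))))          = bridge q
    from (inj₂ (inj₂ (inj₂ (inj₂ (inj₁ q)))))   = hubBridge q
    from (inj₂ (inj₂ (inj₂ (inj₂ (inj₂ q)))))   = hubCorner q

  module _ (V-finite : Finite V) (T-finite : Finite T) where

    Slot-finite : Finite Slot
    Slot-finite = finite-× T-finite (3 , ↔-refl)

    Vertex-finite : Finite Vertex
    Vertex-finite = finite-↔ Vertex↔ (finite-⊎ V-finite (finite-⊎ Slot-finite V-finite))

    Triangle-finite : Finite Triangle
    Triangle-finite = finite-↔ Triangle↔ (finite-⊎ T-finite (finite-⊎ Slot-finite (finite-⊎ T-finite
                                          (finite-⊎ Slot-finite (finite-⊎ Slot-finite Slot-finite)))))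

module Ramsey where

  open import Data.Nat using (_<_; s≤s⁻¹)

  length-filter-∁ : {A : Set} {P : A → Set} (P? : Decidable P) (xs : List A) →
                    length xs ≡ length (filter P? xs) + length (filter (∁? P?) xs)
  length-filter-∁ P? []       = refl
  length-filter-∁ P? (x ∷ xs) with P? x
  ... | yes _ = cong suc (length-filter-∁ P? xs)
  ... | no _  = trans (cong suc (length-filter-∁ P? xs)) (sym (ℕ.+-suc _ _))

  length-filter-filter : {A : Set} {P Q : A → Set} (P? : Decidable P) (Q? : Decidable Q) (xs : List A) →
                         length (filter Q? (filter P? xs)) ≤ length (filter Q? xs)
  length-filter-filter P? Q? xs = length-mono-≤ (⊆-filter-Sublist Q? Q? (λ { refl q → q }) (filter-Sublist P? (⊆-refl {x = xs})))

  pigeonhole : {A : Set} (k K : ℕ) (h : A → ℕ) (ys : List A) → (∀ {y} → y ∈ ys → h y < k) → k * K < length ys →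
               ∃[ r ] (r < k × K < length (filter (λ y → h y ℕ.≟ r) ys))
  pigeonhole zero    K h []      _  ()
  pigeonhole zero    K h (y ∷ _) h< _ = contradiction (h< (here refl)) ℕ.n≮0
  pigeonhole {A} (suc k) K h ys h< big with K ℕ.<? length (filter (λ y → h y ℕ.≟ k) ys)
  ... | yes many = k , ℕ.n<1+n k , many
  ... | no few with pigeonhole k K h rest rest-h< rest-big
    where
    P? : Decidable (λ y → h y ≡ k)
    P? y = h y ℕ.≟ k
    rest : List A
    rest = filter (∁? P?) ys
    rest-h< : ∀ {y} → y ∈ rest → h y < k
    rest-h< y∈ = let (y∈ys , hy≢k) = ∈-filter⁻ (∁? P?) y∈ in ℕ.≤∧≢⇒< (s≤s⁻¹ (h< y∈ys)) hy≢k
    rest-big : k * K < length rest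
    rest-big = ℕ.+-cancelˡ-< K (k * K) (length rest) (ℕ.<-≤-trans big (ℕ.≤-trans (ℕ.≤-reflexive (length-filter-∁ P? ys))
                                                           (ℕ.+-monoˡ-≤ (length rest) (ℕ.≮⇒≥ few))))
  ...   | r , r<k , many = r , ℕ.m<n⇒m<1+n r<k , ℕ.<-≤-trans many (length-filter-filter _ _ ys)

  module _ (k r : ℕ) where

    recolour : ℕ → ℕ
    recolour c with c ℕ.≟ k
    ... | yes _ = r
    ... | no _  = c

    recolour-< : r < suc k → ∀ {c} → c < suc k → c ≢ r → recolour c < k
    recolour-< r≤k {c} c≤k c≢r with c ℕ.≟ k
    ... | yes refl = ℕ.≤∧≢⇒< (s≤s⁻¹ r≤k) (λ r≡k → c≢r (sym r≡k))
    ... | no c≢k   = ℕ.≤∧≢⇒< (s≤s⁻¹ c≤k) c≢k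

    recolour-injective : ∀ {c c′} → c ≢ r → c′ ≢ r → recolour c ≡ recolour c′ → c ≡ c′
    recolour-injective {c} {c′} c≢r c′≢r e with c ℕ.≟ k | c′ ℕ.≟ k
    ... | yes c≡k | yes c′≡k = trans c≡k (sym c′≡k)
    ... | yes _   | no _     = contradiction (sym e) c′≢r
    ... | no _    | yes _    = contradiction e c≢r
    ... | no _    | no _     = e

  ramseyBound : ℕ → ℕ
  ramseyBound zero    = 2
  ramseyBound (suc k) = 2 + suc k * ramseyBound k

  Monochromatic : {A : Set} (_≺_ : A → A → Set) → List A → (A → A → ℕ) → Set
  Monochromatic _≺_ L f = ∃[ x ] ∃[ y ] ∃[ z ] ((x ∈ L × y ∈ L × z ∈ L) × (x ≺ y × x ≺ z × y ≺ z) × f x y ≡ f x z × f x y ≡ f y z)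

  module _ {A : Set} {_≺_ : A → A → Set} (_≺?_ : ∀ x y → Dec (x ≺ y)) where

    ramsey : ∀ k (L : List A) → AllPairs _≺_ L → ramseyBound k ≤ length L → (f : A → A → ℕ) →
             (∀ {y z} → y ∈ L → z ∈ L → y ≺ z → f y z < k) → Monochromatic _≺_ L f
    ramsey zero (y ∷ z ∷ _) ((y≺z ∷ _) ∷ _) _ f f< = contradiction (f< (here refl) (there (here refl)) y≺z) ℕ.n≮0
    ramsey zero    (_ ∷ []) _ (s≤s ()) _ _
    ramsey (suc k) (x ∷ rest) (x≺rest ∷ sorted) (s≤s big) f f< =
      from-class (pigeonhole (suc k) (ramseyBound k) (f x) rest (λ y∈ → f< (here refl) (there y∈) (All.lookup x≺rest y∈)) big)
      where
      from-class : ∃[ r ] (r < suc k × ramseyBound k < length (filter (λ y → f x y ℕ.≟ r) rest)) → Monochromatic _≺_ (x ∷ rest) f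
      from-class (r , r<k , many) = decide (any? (λ y → any? (λ z → (y ≺? z) ×-dec (f y z ℕ.≟ r)) class) class)
        where
        class : List A
        class = filter (λ y → f x y ℕ.≟ r) rest
        ∈class : ∀ {y} → y ∈ class → y ∈ rest × f x y ≡ r
        ∈class = ∈-filter⁻ (λ y → f x y ℕ.≟ r)
        PairOfColour : Set
        PairOfColour = Any (λ y → Any (λ z → y ≺ z × f y z ≡ r) class) class
        colour≢r : ¬ PairOfColour → ∀ {y z} → y ∈ class → z ∈ class → y ≺ z → f y z ≢ r
        colour≢r ¬pair y∈ z∈ y≺z fyz≡r = ¬pair (lose y∈ (lose z∈ (y≺z , fyz≡r)))
        recoloured< : ¬ PairOfColour → ∀ {y z} → y ∈ class → z ∈ class → y ≺ z → recolour k r (f y z) < k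
        recoloured< ¬pair y∈ z∈ y≺z =
          recolour-< k r r<k (f< (there (proj₁ (∈class y∈))) (there (proj₁ (∈class z∈))) y≺z) (colour≢r ¬pair y∈ z∈ y≺z)
        decide : Dec PairOfColour → Monochromatic _≺_ (x ∷ rest) f
        decide (yes pair) with find pair
        ... | y , y∈ , yz with find yz
        ...   | z , z∈ , y≺z , fyz≡r =
          let (y∈rest , fxy≡r) = ∈class y∈ ; (z∈rest , fxz≡r) = ∈class z∈ in
          x , y , z , (here refl , there y∈rest , there z∈rest) ,
          (All.lookup x≺rest y∈rest , All.lookup x≺rest z∈rest , y≺z) , trans fxy≡r (sym fxz≡r) , trans fxy≡r (sym fyz≡r)
        -- No edge inside the class has colour r, so renaming colour k to r leaves only k colours there.
        decide (no ¬pair) with ramsey k class (AllPairs.filter⁺ _ sorted) (ℕ.<⇒≤ many) (λ y z → recolour k r (f y z)) (recoloured< ¬pair)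
        ... | y , z , w , (y∈ , z∈ , w∈) , (y≺z , y≺w , z≺w) , e₁ , e₂ =
          y , z , w , (there (proj₁ (∈class y∈)) , there (proj₁ (∈class z∈)) , there (proj₁ (∈class w∈))) , (y≺z , y≺w , z≺w) ,
          recolour-injective k r (colour≢r ¬pair y∈ z∈ y≺z) (colour≢r ¬pair y∈ w∈ y≺w) e₁ ,
          recolour-injective k r (colour≢r ¬pair y∈ z∈ y≺z) (colour≢r ¬pair z∈ w∈ z≺w) e₂

-- Vertices of the linear complex are the edges i < j of K_N, triangles are the triangles
-- a < b < c, and corner t r is the edge of t opposite to its r-th element.  Taking N = m + 4
-- puts every edge in at least two triangles, as the construction of the surface requires.
module CompleteGraph (m : ℕ) where

  open import Data.Fin using (_<_; _<?_; _≟_)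
  open import Data.Fin.Properties using (<-trans; <-cmp; <-asym; <⇒≢; ≤-antisym; ≤-refl)

  N : ℕ
  N = suc (suc (suc (suc m)))

  recompute< : {a b : Fin N} → .(a < b) → a < b
  recompute< {a} {b} a<b = recompute (a <? b) a<b

  record Pair : Set where
    constructor pair
    field
      i j   : Fin N
      .i<j  : i < j

  record Triple : Set where
    constructor triple
    field
      a b c : Fin N
      .a<b  : a < b
      .b<c  : b < c

  pair-≡ : ∀ {i j i′ j′} .{p : i < j} .{p′ : i′ < j′} → i ≡ i′ → j ≡ j′ → pair i j p ≡ pair i′ j′ p′
  pair-≡ refl refl = refl

  triple-≡ : ∀ {a b c a′ b′ c′} .{p q p′ q′} → a ≡ a′ → b ≡ b′ → c ≡ c′ → triple a b c p q ≡ triple a′ b′ c′ p′ q′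
  triple-≡ refl refl refl = refl

  corner : Triple → Corner → Pair
  corner (triple a b c a<b b<c) c₀ = pair b c b<c
  corner (triple a b c a<b b<c) c₁ = pair a c (<-trans a<b b<c)
  corner (triple a b c a<b b<c) c₂ = pair a b a<b

  element : Triple → Corner → Fin N
  element (triple a b c _ _) c₀ = a
  element (triple a b c _ _) c₁ = b
  element (triple a b c _ _) c₂ = c

  _∈ᵖ_ : Fin N → Pair → Set
  y ∈ᵖ pair i j _ = y ≡ i ⊎ y ≡ j

  _∈ᵗ_ : Fin N → Triple → Set
  y ∈ᵗ t = ∃[ ρ ] (y ≡ element t ρ)

  corner-injective : ∀ t {r r′} → corner t r ≡ corner t r′ → r ≡ r′
  corner-injective t {c₀} {c₀} _ = refl
  corner-injective t {c₁} {c₁} _ = refl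
  corner-injective t {c₂} {c₂} _ = refl
  corner-injective (triple a b c a<b b<c) {c₀} {c₁} e = contradiction (sym (cong Pair.i e)) (<⇒≢ (recompute< a<b))
  corner-injective (triple a b c a<b b<c) {c₀} {c₂} e = contradiction (sym (cong Pair.i e)) (<⇒≢ (recompute< a<b))
  corner-injective (triple a b c a<b b<c) {c₁} {c₀} e = contradiction (cong Pair.i e) (<⇒≢ (recompute< a<b))
  corner-injective (triple a b c a<b b<c) {c₁} {c₂} e = contradiction (sym (cong Pair.j e)) (<⇒≢ (recompute< b<c))
  corner-injective (triple a b c a<b b<c) {c₂} {c₀} e = contradiction (cong Pair.i e) (<⇒≢ (recompute< a<b))
  corner-injective (triple a b c a<b b<c) {c₂} {c₁} e = contradiction (cong Pair.j e) (<⇒≢ (recompute< b<c))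

  element-next-∈ : ∀ t r → element t (next r) ∈ᵖ corner t r
  element-next-∈ (triple a b c _ _) c₀ = inj₁ refl
  element-next-∈ (triple a b c _ _) c₁ = inj₂ refl
  element-next-∈ (triple a b c _ _) c₂ = inj₁ refl

  element-prev-∈ : ∀ t r → element t (prev r) ∈ᵖ corner t r
  element-prev-∈ (triple a b c _ _) c₀ = inj₂ refl
  element-prev-∈ (triple a b c _ _) c₁ = inj₁ refl
  element-prev-∈ (triple a b c _ _) c₂ = inj₂ refl

  element-∈-corner : ∀ t {ρ r} → ρ ≢ r → element t ρ ∈ᵖ corner t r
  element-∈-corner t {r = r} ρ≢r with ≢⇒next⊎prev ρ≢r
  ... | inj₁ refl = element-next-∈ t r
  ... | inj₂ refl = element-prev-∈ t r

  corner-⊆ : ∀ {y} t r → y ∈ᵖ corner t r → y ∈ᵗ t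
  corner-⊆ (triple a b c _ _) c₀ (inj₁ refl) = c₁ , refl
  corner-⊆ (triple a b c _ _) c₀ (inj₂ refl) = c₂ , refl
  corner-⊆ (triple a b c _ _) c₁ (inj₁ refl) = c₀ , refl
  corner-⊆ (triple a b c _ _) c₁ (inj₂ refl) = c₂ , refl
  corner-⊆ (triple a b c _ _) c₂ (inj₁ refl) = c₀ , refl
  corner-⊆ (triple a b c _ _) c₂ (inj₂ refl) = c₁ , refl

  corners-cover : ∀ {y} t {r₁ r₂} → r₁ ≢ r₂ → y ∈ᵗ t → y ∈ᵖ corner t r₁ ⊎ y ∈ᵖ corner t r₂
  corners-cover t {r₁} r₁≢r₂ (ρ , refl) with ρ ≟ r₁
  ... | yes refl = inj₂ (element-∈-corner t r₁≢r₂)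
  ... | no ρ≢r₁  = inj₁ (element-∈-corner t ρ≢r₁)

  least-element : ∀ t ρ → element t c₀ Fin.≤ element t ρ
  least-element (triple a b c a<b b<c) c₀ = ≤-refl
  least-element (triple a b c a<b b<c) c₁ = ℕ.<⇒≤ (recompute< a<b)
  least-element (triple a b c a<b b<c) c₂ = ℕ.<⇒≤ (<-trans (recompute< a<b) (recompute< b<c))

  greatest-element : ∀ t ρ → element t ρ Fin.≤ element t c₂
  greatest-element (triple a b c a<b b<c) c₀ = ℕ.<⇒≤ (<-trans (recompute< a<b) (recompute< b<c))
  greatest-element (triple a b c a<b b<c) c₁ = ℕ.<⇒≤ (recompute< b<c)
  greatest-element (triple a b c a<b b<c) c₂ = ≤-refl

  same-elements⇒≡ : ∀ t t′ → (∀ {y} → y ∈ᵗ t → y ∈ᵗ t′) → (∀ {y} → y ∈ᵗ t′ → y ∈ᵗ t) → t ≡ t′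
  same-elements⇒≡ t@(triple a b c a<b b<c) t′@(triple a′ b′ c′ a′<b′ b′<c′) t⊆t′ t′⊆t = triple-≡ a≡a′ b≡b′ c≡c′
    where
    a≡a′ : a ≡ a′
    a≡a′ = let (ρ , a′≡) = t′⊆t (c₀ , refl) ; (ρ′ , a≡) = t⊆t′ (c₀ , refl) in
           ≤-antisym (subst (a Fin.≤_) (sym a′≡) (least-element t ρ)) (subst (a′ Fin.≤_) (sym a≡) (least-element t′ ρ′))
    c≡c′ : c ≡ c′
    c≡c′ = let (ρ , c′≡) = t′⊆t (c₂ , refl) ; (ρ′ , c≡) = t⊆t′ (c₂ , refl) in
           ≤-antisym (subst (Data.Fin._≤ c′) (sym c≡) (greatest-element t′ ρ′)) (subst (Data.Fin._≤ c) (sym c′≡) (greatest-element t ρ))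
    b≡b′ : b ≡ b′
    b≡b′ with t⊆t′ (c₁ , refl)
    ... | c₀ , b≡a′ = contradiction (trans b≡a′ (sym a≡a′)) (λ e → <⇒≢ (recompute< a<b) (sym e))
    ... | c₁ , b≡b′ = b≡b′
    ... | c₂ , b≡c′ = contradiction (trans b≡c′ (sym c≡c′)) (<⇒≢ (recompute< b<c))

  shared-corners-⊆ : ∀ {t t′ r₁ r₂ r₁′ r₂′} → r₁ ≢ r₂ → corner t r₁ ≡ corner t′ r₁′ → corner t r₂ ≡ corner t′ r₂′ →
                     ∀ {y} → y ∈ᵗ t → y ∈ᵗ t′
  shared-corners-⊆ {t} {t′} {r₁′ = r₁′} {r₂′ = r₂′} r₁≢r₂ e₁ e₂ y∈ with corners-cover t r₁≢r₂ y∈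
  ... | inj₁ y∈₁ = corner-⊆ t′ r₁′ (subst (_ ∈ᵖ_) e₁ y∈₁)
  ... | inj₂ y∈₂ = corner-⊆ t′ r₂′ (subst (_ ∈ᵖ_) e₂ y∈₂)

  linear : ∀ {t t′ r₁ r₂ r₁′ r₂′} → r₁ ≢ r₂ → corner t r₁ ≡ corner t′ r₁′ → corner t r₂ ≡ corner t′ r₂′ → t ≡ t′
  linear {t} {t′} {r₁′ = r₁′} {r₂′ = r₂′} r₁≢r₂ e₁ e₂ =
    same-elements⇒≡ t t′ (shared-corners-⊆ r₁≢r₂ e₁ e₂) (shared-corners-⊆ r₁′≢r₂′ (sym e₁) (sym e₂))
    where
    r₁′≢r₂′ : r₁′ ≢ r₂′
    r₁′≢r₂′ refl = r₁≢r₂ (corner-injective t (trans e₁ (sym e₂)))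

  data Between (i j l : Fin N) : Set where
    below   : l < i → Between i j l
    between : i < l → l < j → Between i j l
    above   : j < l → Between i j l

  between? : ∀ {i j l} → l ≢ i → l ≢ j → Between i j l
  between? {i} {j} {l} l≢i l≢j with <-cmp l i | <-cmp l j
  ... | tri< l<i _ _ | _            = below l<i
  ... | tri≈ _ l≡i _ | _            = contradiction l≡i l≢i
  ... | tri> _ _ i<l | tri< l<j _ _ = between i<l l<j
  ... | tri> _ _ _   | tri≈ _ l≡j _ = contradiction l≡j l≢j
  ... | tri> _ _ _   | tri> _ _ j<l = above j<l

  insert : (x : Pair) (l : Fin N) → Between (Pair.i x) (Pair.j x) l → Triple × Corner
  insert (pair i j i<j) l (below l<i)       = triple l i j l<i i<j , c₀
  insert (pair i j i<j) l (between i<l l<j) = triple i l j i<l l<j , c₁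
  insert (pair i j i<j) l (above j<l)       = triple i j l i<j j<l , c₂

  insert-corner : ∀ x l b → uncurry corner (insert x l b) ≡ x
  insert-corner (pair i j i<j) l (below _)     = refl
  insert-corner (pair i j i<j) l (between _ _) = refl
  insert-corner (pair i j i<j) l (above _)     = refl

  insert-eta : ∀ t r {l} (b : Between (Pair.i (corner t r)) (Pair.j (corner t r)) l) → l ≡ element t r → insert (corner t r) l b ≡ (t , r)
  insert-eta (triple a b c a<b b<c) c₀ (below _)         refl = refl
  insert-eta (triple a b c a<b b<c) c₀ (between b<a _)   refl = contradiction b<a (<-asym (recompute< a<b))
  insert-eta (triple a b c a<b b<c) c₀ (above c<a)       refl = contradiction c<a (<-asym (<-trans (recompute< a<b) (recompute< b<c)))
  insert-eta (triple a b c a<b b<c) c₁ (below b<a)       refl = contradiction b<a (<-asym (recompute< a<b))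
  insert-eta (triple a b c a<b b<c) c₁ (between _ _)     refl = refl
  insert-eta (triple a b c a<b b<c) c₁ (above c<b)       refl = contradiction c<b (<-asym (recompute< b<c))
  insert-eta (triple a b c a<b b<c) c₂ (below c<a)       refl = contradiction c<a (<-asym (<-trans (recompute< a<b) (recompute< b<c)))
  insert-eta (triple a b c a<b b<c) c₂ (between _ c<b)   refl = contradiction c<b (<-asym (recompute< b<c))
  insert-eta (triple a b c a<b b<c) c₂ (above _)         refl = refl

  ends-≢ : ∀ x → Pair.i x ≢ Pair.j x
  ends-≢ (pair i j i<j) = <⇒≢ (recompute< i<j)

  element-≢ˡ : ∀ t r → element t r ≢ Pair.i (corner t r)
  element-≢ˡ (triple a b c a<b b<c) c₀ = <⇒≢ (recompute< a<b)
  element-≢ˡ (triple a b c a<b b<c) c₁ = λ e → <⇒≢ (recompute< a<b) (sym e)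
  element-≢ˡ (triple a b c a<b b<c) c₂ = λ e → <⇒≢ (<-trans (recompute< a<b) (recompute< b<c)) (sym e)

  element-≢ʳ : ∀ t r → element t r ≢ Pair.j (corner t r)
  element-≢ʳ (triple a b c a<b b<c) c₀ = <⇒≢ (<-trans (recompute< a<b) (recompute< b<c))
  element-≢ʳ (triple a b c a<b b<c) c₁ = <⇒≢ (recompute< b<c)
  element-≢ʳ (triple a b c a<b b<c) c₂ = λ e → <⇒≢ (recompute< b<c) (sym e)

  star-view : ∀ x k → Σ (Fin N) (Between (Pair.i x) (Pair.j x))
  star-view x k = punchIn₂ (ends-≢ x) k , between? (punchIn₂-≢ˡ (ends-≢ x) k) (punchIn₂-≢ʳ (ends-≢ x) k)

  star : Pair → Fin (suc (suc m)) → Triple × Corner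
  star x k = insert x (proj₁ (star-view x k)) (proj₂ (star-view x k))

  position : Triple × Corner → Fin (suc (suc m))
  position (t , r) = punchOut₂ (ends-≢ (corner t r)) (element-≢ˡ t r) (element-≢ʳ t r)

  star-corner : ∀ x k → uncurry corner (star x k) ≡ x
  star-corner x k = insert-corner x (proj₁ (star-view x k)) (proj₂ (star-view x k))

  star-position : ∀ q → star (uncurry corner q) (position q) ≡ q
  star-position (t , r) = insert-eta t r _ (punchIn₂-punchOut₂ (ends-≢ (corner t r)) (element-≢ˡ t r) (element-≢ʳ t r))

  position-insert : ∀ x l b (l≢i : l ≢ Pair.i x) (l≢j : l ≢ Pair.j x) → position (insert x l b) ≡ punchOut₂ (ends-≢ x) l≢i l≢j
  position-insert (pair i j i<j) l (below l<i) l≢i l≢j =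
    punchOut₂-irrelevant (ends-≢ (pair i j i<j)) (element-≢ˡ (triple l i j l<i i<j) c₀) l≢i (element-≢ʳ (triple l i j l<i i<j) c₀) l≢j
  position-insert (pair i j i<j) l (between i<l l<j) l≢i l≢j =
    punchOut₂-irrelevant (ends-≢ (pair i j i<j)) (element-≢ˡ (triple i l j i<l l<j) c₁) l≢i (element-≢ʳ (triple i l j i<l l<j) c₁) l≢j
  position-insert (pair i j i<j) l (above j<l) l≢i l≢j =
    punchOut₂-irrelevant (ends-≢ (pair i j i<j)) (element-≢ˡ (triple i j l i<j j<l) c₂) l≢i (element-≢ʳ (triple i j l i<j j<l) c₂) l≢j

  position-star : ∀ x k → position (star x k) ≡ k
  position-star x k = trans (position-insert x (proj₁ (star-view x k)) (proj₂ (star-view x k)) (punchIn₂-≢ˡ (ends-≢ x) k) (punchIn₂-≢ʳ (ends-≢ x) k))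
                            (punchOut₂-punchIn₂ (ends-≢ x) k)

  edge₀₁ : Pair
  edge₀₁ = pair zero (suc zero) z<s

  from-edge₀ : ∀ j .(0<j : _) → Star (Adjacent corner) (pair zero j 0<j) edge₀₁
  from-edge₀ zero             0<0 = contradiction (recompute< 0<0) (λ ())
  from-edge₀ (suc zero)       _   = ε
  from-edge₀ (suc (suc j))    _   = (triple zero (suc zero) (suc (suc j)) z<s (s<s z<s) , c₁ , c₂ , (λ ()) , refl , refl) ◅ ε

  to-edge₀₁ : ∀ x → Star (Adjacent corner) x edge₀₁
  to-edge₀₁ (pair zero j 0<j)    = from-edge₀ j 0<j
  to-edge₀₁ (pair (suc i) j i<j) = (triple zero (suc i) j z<s i<j , c₀ , c₁ , (λ ()) , refl , refl) ◅ from-edge₀ j _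

  pairs-connected : ∀ x y → Star (Adjacent corner) x y
  pairs-connected x y = to-edge₀₁ x ◅◅ reverse Adjacent-sym (to-edge₀₁ y)

  _≟ᵖ_ : DecidableEquality Pair
  pair i j _ ≟ᵖ pair i′ j′ _ = map′ (λ (e , e′) → pair-≡ e e′) (λ e → cong Pair.i e , cong Pair.j e) ((i ≟ i′) ×-dec (j ≟ j′))

  _≟ᵗ_ : DecidableEquality Triple
  triple a b c _ _ ≟ᵗ triple a′ b′ c′ _ _ =
    map′ (λ (e , e′ , e″) → triple-≡ e e′ e″) (λ e → cong Triple.a e , cong Triple.b e , cong Triple.c e)
         ((a ≟ a′) ×-dec (b ≟ b′) ×-dec (c ≟ c′))

  pairsOn : Fin N × Fin N → List Pair
  pairsOn (i , j) with i <? j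
  ... | yes i<j = pair i j i<j ∷ []
  ... | no _    = []

  triplesOn : Fin N × Fin N × Fin N → List Triple
  triplesOn (a , b , c) with a <? b | b <? c
  ... | yes a<b | yes b<c = triple a b c a<b b<c ∷ []
  ... | _       | _       = []

  ∈-pairsOn : ∀ x → x ∈ pairsOn (Pair.i x , Pair.j x)
  ∈-pairsOn (pair i j i<j) with i <? j
  ... | yes _  = here refl
  ... | no i≮j = contradiction (recompute< i<j) i≮j

  ∈-triplesOn : ∀ t → t ∈ triplesOn (Triple.a t , Triple.b t , Triple.c t)
  ∈-triplesOn (triple a b c a<b b<c) with a <? b | b <? c
  ... | yes _  | yes _  = here refl
  ... | no a≮b | _      = contradiction (recompute< a<b) a≮b
  ... | yes _  | no b≮c = contradiction (recompute< b<c) b≮c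

  pairs-finite : Finite Pair
  pairs-finite = finite _≟ᵖ_ (concatMap pairsOn (cartesianProduct (allFin N) (allFin N)))
    (λ x → ∈-concatMap⁺ pairsOn (lose (∈-cartesianProduct⁺ (∈-allFin _) (∈-allFin _)) (∈-pairsOn x)))

  triples-finite : Finite Triple
  triples-finite = finite _≟ᵗ_ (concatMap triplesOn (cartesianProduct (allFin N) (cartesianProduct (allFin N) (allFin N))))
    (λ t → ∈-concatMap⁺ triplesOn (lose (∈-cartesianProduct⁺ (∈-allFin _) (∈-cartesianProduct⁺ (∈-allFin _) (∈-allFin _))) (∈-triplesOn t)))

  open Completion corner corner-injective linear star position star-corner star-position position-star pairs-connected
                  (triple zero (suc zero) (suc (suc zero)) z<s (s<s z<s))

  module Surface = Relabel triangle (proj₂ (Vertex-finite pairs-finite triples-finite)) (proj₂ (Triangle-finite pairs-finite triples-finite))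

  surface-closed : IsClosedSurface Surface.relabelled
  surface-closed = Surface.isClosedSurface isClosedSurface

  -- Ramsey's theorem colours all ordered pairs; the junk value 0 off the edges a < b is never inspected.
  edgeColouring : (Pair → ℕ) → Fin N → Fin N → ℕ
  edgeColouring f a b with a <? b
  ... | yes a<b = f (pair a b a<b)
  ... | no _    = 0

  edgeColouring-pair : ∀ f a b .(a<b : a < b) → edgeColouring f a b ≡ f (pair a b a<b)
  edgeColouring-pair f a b a<b with a <? b
  ... | yes _  = refl
  ... | no a≮b = contradiction (recompute< a<b) a≮b

  edgeColouring-< : ∀ f {k} → 0 Data.Nat.< k → (∀ x → f x Data.Nat.< k) → ∀ a b → edgeColouring f a b Data.Nat.< k
  edgeColouring-< f 0<k f< a b with a <? b
  ... | yes _ = f< _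
  ... | no _  = 0<k

  surface-chromatic : ∀ k → Ramsey.ramseyBound k ≤ N → ChromaticAtLeast 2 Surface.relabelled k
  surface-chromatic k bound m m<k (c , colouring) =
    monochromatic-face (Ramsey.ramsey _<?_ k (allFin N) (AllPairs.tabulate⁺-< id)
                                      (subst (Ramsey.ramseyBound k ≤_) (sym (length-tabulate id)) bound) colour
                                      (λ {a} {b} _ _ _ → edgeColouring-< colourOf (ℕ.≤-<-trans z≤n m<k) (λ _ → ℕ.<-trans (toℕ<n _) m<k) a b))
    where
    colourOf : Pair → ℕ
    colourOf x = toℕ (c (Surface.code (old x)))
    colour : Fin N → Fin N → ℕ
    colour = edgeColouring colourOf
    same-colour : ∀ {a b a′ b′} .{p : a < b} .{p′ : a′ < b′} → colour a b ≡ colour a′ b′ →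
                  c (Surface.code (old (pair a b p))) ≡ c (Surface.code (old (pair a′ b′ p′)))
    same-colour {a} {b} {a′} {b′} {p} {p′} e =
      toℕ-injective (trans (sym (edgeColouring-pair colourOf a b p)) (trans e (edgeColouring-pair colourOf a′ b′ p′)))
    monochromatic-face : Ramsey.Monochromatic _<_ (allFin N) colour → ⊥
    monochromatic-face (a , b , d , _ , (a<b , _ , b<d) , ab≡ad , ab≡bd) =
      Surface.no-monochromatic-triangle {c = c} colouring (face abd) (sides-distinct (face abd))
        (same-colour {b} {d} {a} {d} (trans (sym ab≡bd) ab≡ad) , same-colour {b} {d} {a} {b} (sym ab≡bd) ,
         same-colour {a} {d} {a} {b} (sym ab≡ad))
      where
      abd : Triple
      abd = triple a b d a<b b<d

mainTheorem2 : ∀ (k : ℕ) → ∃[ n ] Σ (TriComplex n) (λ K → IsClosedSurface K × ChromaticAtLeast 2 K k)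
mainTheorem2 k = _ , Surface.relabelled , surface-closed , surface-chromatic k (ℕ.m≤n+m _ 4)
  where open CompleteGraph (Ramsey.ramseyBound k)
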